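{- Let $f(x)=\dfrac{1}{x^4}\sum_{k=1}^\infty\dfrac{x^{2^{k+1}}}{1-x^{2^k}}$. Then for every $m\ge0$: $H_{8m+i}(f)\equiv1\pmod 2$ for $i=0,1,2,3,4,5$ and $H_{8m+6}(f)\equiv H_{8m+7}(f)\equiv0\pmod2$.
   Context: For $f=\sum a_ix^i$, $H_n(f)=\det(a_{i+j})_{0\le i,j\le n-1}$ for $n\ge1$ and $H_0(f)=1$. -}

module Defs where

open import Data.Nat as ℕ using (ℕ; zero; suc)
open import Data.Nat.Properties using (_≟_)
open import Data.Integer as ℤ using (ℤ; +_)
open import Data.Fin using (Fin; zero; suc; toℕ; punchIn)
open import Relation.Nullary.Decidable using (⌊_⌋)
open import Data.Bool using (if_then_else_)

sumℕ : ℕ → (ℕ → ℕ) → ℕ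
sumℕ zero    g = 0
sumℕ (suc n) g = sumℕ n g ℕ.+ g n

-- Coefficient of x^n in
--   f(x) = x^{-4} Σ_{k≥1} x^{2^{k+1}} / (1 - x^{2^k})
--        = Σ_{k≥1} Σ_{j≥0} x^{2^{k+1} + j·2^k - 4}
-- i.e. the number of pairs (k , j) with k ≥ 1, j ≥ 0 and
--   2^{k+1} + j·2^k = n + 4.
-- Every such pair has k < n + 4 and j < n + 4, so the finite ranges
-- below enumerate all of them.
coeff : ℕ → ℕ
coeff n = sumℕ (n ℕ.+ 4) λ k → sumℕ (n ℕ.+ 4) λ j →
  if ⌊ 2 ℕ.^ (suc k ℕ.+ 1) ℕ.+ j ℕ.* 2 ℕ.^ suc k ≟ n ℕ.+ 4 ⌋ then 1 else 0

f : ℕ → ℤ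
f n = + coeff n

sumFin : (n : ℕ) → (Fin n → ℤ) → ℤ
sumFin zero    g = + 0
sumFin (suc n) g = g zero ℤ.+ sumFin n (λ i → g (suc i))

sign : ℕ → ℤ
sign zero          = + 1
sign (suc zero)    = ℤ.- (+ 1)
sign (suc (suc i)) = sign i

det : (n : ℕ) → (Fin n → Fin n → ℤ) → ℤ
det zero    M = + 1
det (suc n) M = sumFin (suc n) λ j →
  sign (toℕ j) ℤ.* M zero j ℤ.* det n (λ r c → M (suc r) (punchIn j c))

H : ℕ → (ℕ → ℤ) → ℤ
H n a = det n (λ i j → a (toℕ i ℕ.+ toℕ j))

-- Modulo 2, H_n(f) is the determinant over 𝔽₂ of the Hankel matrix A of the coefficients c_n of f.
-- Counting the k with 2^k ∣ n + 4 and 2^(k+1) ≤ n + 4 gives c_odd = 0, c_0 = c_2 = 1 and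
-- c_(2t+4) = c_t + 1, which identifies c_(2t) with the moments ⟨J^t e₀, e₀⟩ of the tridiagonal
-- operator J over 𝔽₂ with unit off-diagonals and diagonal [i even]. Interleaving the vectors J^t e₀
-- by parity gives a unit lower triangular U with A = U K and Kᵀ = U D, where D is the identity on
-- even indices and J on odd ones. So H_n ≡ det D_n, and expanding the banded D_n along its first row
-- gives a continuant recursion whose values 1, 1, 1, 1, 1, 1, 0, 0 repeat with period 8.

module Submission where

open import Defs
open import Data.Nat using (ℕ)
open import Data.Fin using (Fin; toℕ)
open import Data.Integer using (ℤ; +_; _-_)
open import Data.Integer.Divisibility using (_∣_)
open import Data.Product using (_×_)
open import Data.Nat as N using ()

open import Data.Bool using (if_then_else_)
open import Data.Empty using (⊥-elim)
open import Data.Fin using (zero; suc; punchIn; fromℕ<)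
open import Data.Fin.Properties
  using (_≟_; suc-injective; toℕ<n; toℕ-inject₁; toℕ-fromℕ; toℕ-fromℕ<; toℕ-injective; punchInᵢ≢i)
open import Data.Integer as ℤ using (-[1+_]; ∣_∣; _⊖_)
import Data.Integer.Properties as ℤₚ
open import Data.Nat using (zero; suc; _+_; _*_; _^_; _∸_; _≤_; _<_; z≤n; s≤s; parity; _<?_; ⌊_/2⌋)
open import Data.Nat.Divisibility as ℕᵈ using (divides)
open import Data.Nat.Induction using (<-rec)
open import Data.Nat.Properties
  using (≤-refl; ≤-trans; <⇒≤; n≤1+n; m≤m+n; m≤n+m; +-suc; +-comm; m+[n∸m]≡n; ≮⇒≥; <-irrefl; ≤∧≢⇒<; m<1+n⇒m≤n)
import Data.Nat.Properties as ℕₚ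
open import Data.Nat.Tactic.RingSolver using (solve-∀)
open import Data.Parity.Base using (Parity; 0ℙ; 1ℙ; _⁻¹)
  renaming (_+_ to infixl 6 _⊕_; _*_ to infixl 7 _·_)
import Data.Parity.Properties as Parityₚ
open import Data.Product using (_,_; proj₁; proj₂)
open import Data.Sum using (_⊎_; inj₁; inj₂)
open import Data.Vec.Functional using (updateAt)
open import Data.Vec.Functional.Properties using (updateAt-updates; updateAt-minimal)
open import Function using (_∘_)
open import Relation.Binary.PropositionalEquality
open import Relation.Nullary using (¬_; Dec; yes; no)
open import Relation.Nullary.Decidable using (⌊_⌋)

open import Algebra.Properties.Semiring.Sum Parityₚ.+-*-semiring
  using (sum; sum-cong-≗; sum-replicate-zero; sum-init-last; sum-remove; ∑-distrib-+; ∑-comm; *-distribˡ-sum)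

⁻¹-⊕-⁻¹ : ∀ p q → p ⁻¹ ⊕ q ⁻¹ ≡ p ⊕ q
⁻¹-⊕-⁻¹ 0ℙ 0ℙ = refl
⁻¹-⊕-⁻¹ 0ℙ 1ℙ = refl
⁻¹-⊕-⁻¹ 1ℙ 0ℙ = refl
⁻¹-⊕-⁻¹ 1ℙ 1ℙ = refl

⊕-cancel : ∀ x y → x ⊕ y ≡ 0ℙ → x ≡ y
⊕-cancel 0ℙ 0ℙ _ = refl
⊕-cancel 1ℙ 1ℙ _ = refl

⊕-moveˡ : ∀ {x a y} → x ≡ a ⊕ y → y ≡ a ⊕ x
⊕-moveˡ {a = 0ℙ} refl = refl
⊕-moveˡ {a = 1ℙ} {y} refl = sym (Parityₚ.⁻¹-involutive y)

⊕-reverse₃ : ∀ a b c → a ⊕ b ⊕ c ≡ c ⊕ b ⊕ a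
⊕-reverse₃ a b c = begin
  a ⊕ b ⊕ c     ≡⟨ Parityₚ.+-comm (a ⊕ b) c ⟩
  c ⊕ (a ⊕ b)   ≡⟨ cong (c ⊕_) (Parityₚ.+-comm a b) ⟩
  c ⊕ (b ⊕ a)   ≡⟨ Parityₚ.+-assoc c b a ⟨
  c ⊕ b ⊕ a     ∎
  where open ≡-Reasoning

⊕-sandwich : ∀ x y → x ⊕ y ⊕ x ≡ y
⊕-sandwich x y = trans (Parityₚ.+-comm (x ⊕ y) x) (trans (sym (Parityₚ.+-assoc x x y)) (cong (_⊕ y) (Parityₚ.p+p≡0ℙ x)))

·-swapˡ : ∀ a b x → a · (b · x) ≡ b · (a · x)
·-swapˡ 0ℙ 0ℙ x = refl
·-swapˡ 0ℙ 1ℙ x = refl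
·-swapˡ 1ℙ 0ℙ x = refl
·-swapˡ 1ℙ 1ℙ x = refl

·-idem-assoc : ∀ a b → a · (a · b) ≡ a · b
·-idem-assoc a b = trans (sym (Parityₚ.*-assoc a a b)) (cong (_· b) (Parityₚ.*-idem a))

·-distribʳ-⊕₃ : ∀ a b c v → (a ⊕ b ⊕ c) · v ≡ a · v ⊕ b · v ⊕ c · v
·-distribʳ-⊕₃ a b c v = trans (Parityₚ.*-distribʳ-+ v (a ⊕ b) c) (cong (_⊕ c · v) (Parityₚ.*-distribʳ-+ v a b))

·-distribˡ-⊕₃ : ∀ v a b c → v · (a ⊕ b ⊕ c) ≡ v · a ⊕ v · b ⊕ v · c
·-distribˡ-⊕₃ v a b c = trans (Parityₚ.*-distribˡ-+ v (a ⊕ b) c) (cong (_⊕ v · c) (Parityₚ.*-distribˡ-+ v a b))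

parity-suc : ∀ n → parity (suc n) ≡ parity n ⁻¹
parity-suc zero = refl
parity-suc (suc zero) = refl
parity-suc (suc (suc n)) = parity-suc n

sum-zero : ∀ {n} (g : Fin n → Parity) → (∀ i → g i ≡ 0ℙ) → sum g ≡ 0ℙ
sum-zero {n} g g≡0 = trans (sum-cong-≗ g≡0) (sum-replicate-zero n)

sum-except : ∀ {n} (a b : Fin n → Parity) r → b r ≡ 0ℙ → (∀ p → p ≢ r → a p ≡ b p) →
  sum a ≡ a r ⊕ sum b
sum-except {suc n} a b r bᵣ≡0 a≡b = begin
  sum a                                        ≡⟨ sum-remove {i = r} a ⟩
  a r ⊕ sum (a ∘ punchIn r)                    ≡⟨ cong (a r ⊕_) (sum-cong-≗ λ q → a≡b (punchIn r q) (punchInᵢ≢i r q)) ⟩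
  a r ⊕ sum (b ∘ punchIn r)                    ≡⟨ cong (λ z → a r ⊕ (z ⊕ sum (b ∘ punchIn r))) bᵣ≡0 ⟨
  a r ⊕ (b r ⊕ sum (b ∘ punchIn r))            ≡⟨ cong (a r ⊕_) (sum-remove {i = r} b) ⟨
  a r ⊕ sum b                                  ∎
  where open ≡-Reasoning

sum-symmetric : ∀ n (F : Fin n → Fin n → Parity) → (∀ i j → F i j ≡ F j i) →
  sum (λ i → sum (λ j → F i j)) ≡ sum (λ i → F i i)
sum-symmetric zero    F F-sym = refl
sum-symmetric (suc n) F F-sym = begin
  (F zero zero ⊕ A) ⊕ sum (λ i → F (suc i) zero ⊕ sum (λ j → F (suc i) (suc j)))
    ≡⟨ cong ((F zero zero ⊕ A) ⊕_) (∑-distrib-+ (λ i → F (suc i) zero) _) ⟩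
  (F zero zero ⊕ A) ⊕ (sum (λ i → F (suc i) zero) ⊕ C)
    ≡⟨ cong (λ z → (F zero zero ⊕ A) ⊕ (z ⊕ C)) (sum-cong-≗ λ i → F-sym (suc i) zero) ⟩
  (F zero zero ⊕ A) ⊕ (A ⊕ C)
    ≡⟨ ⊕-pair-cancel (F zero zero) A C ⟩
  F zero zero ⊕ C
    ≡⟨ cong (F zero zero ⊕_) (sum-symmetric n (λ i j → F (suc i) (suc j)) (λ i j → F-sym (suc i) (suc j))) ⟩
  F zero zero ⊕ sum (λ i → F (suc i) (suc i)) ∎
  where
  open ≡-Reasoning
  A = sum (λ j → F zero (suc j))
  C = sum (λ i → sum (λ j → F (suc i) (suc j)))
  ⊕-pair-cancel : ∀ x a c → (x ⊕ a) ⊕ (a ⊕ c) ≡ x ⊕ c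
  ⊕-pair-cancel x a c = begin
    (x ⊕ a) ⊕ (a ⊕ c)   ≡⟨ Parityₚ.+-assoc x a (a ⊕ c) ⟩
    x ⊕ (a ⊕ (a ⊕ c))   ≡⟨ cong (x ⊕_) (Parityₚ.+-assoc a a c) ⟨
    x ⊕ (a ⊕ a ⊕ c)     ≡⟨ cong (λ z → x ⊕ (z ⊕ c)) (Parityₚ.p+p≡0ℙ a) ⟩
    x ⊕ c               ∎

-- Reduction modulo 2

parityℤ : ℤ → Parity
parityℤ x = parity ∣ x ∣

parity-∣⊖∣ : ∀ m n → parity ∣ m ⊖ n ∣ ≡ parity m ⊕ parity n
parity-∣⊖∣ m zero = sym (Parityₚ.+-identityʳ _)
parity-∣⊖∣ zero (suc n) = cong parity (ℤₚ.∣m⊖n∣≡∣n⊖m∣ 0 (suc n))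
parity-∣⊖∣ (suc m) (suc n) = begin
  parity ∣ suc m ⊖ suc n ∣           ≡⟨ cong (parity ∘ ∣_∣) (ℤₚ.[1+m]⊖[1+n]≡m⊖n m n) ⟩
  parity ∣ m ⊖ n ∣                   ≡⟨ parity-∣⊖∣ m n ⟩
  parity m ⊕ parity n                ≡⟨ ⁻¹-⊕-⁻¹ (parity m) (parity n) ⟨
  parity m ⁻¹ ⊕ parity n ⁻¹          ≡⟨ cong₂ _⊕_ (parity-suc m) (parity-suc n) ⟨
  parity (suc m) ⊕ parity (suc n)    ∎
  where open ≡-Reasoning

parityℤ-+ : ∀ x y → parityℤ (x ℤ.+ y) ≡ parityℤ x ⊕ parityℤ y
parityℤ-+ (+ m)    (+ n)    = Parityₚ.+-homo-+ m n
parityℤ-+ (+ m)    -[1+ n ] = parity-∣⊖∣ m (suc n)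
parityℤ-+ -[1+ m ] (+ n)    = trans (parity-∣⊖∣ n (suc m)) (Parityₚ.+-comm (parity n) _)
parityℤ-+ -[1+ m ] -[1+ n ] =
  trans (cong parity (sym (+-suc (suc m) n))) (Parityₚ.+-homo-+ (suc m) (suc n))

parityℤ-* : ∀ x y → parityℤ (x ℤ.* y) ≡ parityℤ x · parityℤ y
parityℤ-* x y = trans (cong parity (ℤₚ.abs-* x y)) (Parityₚ.*-homo-* ∣ x ∣ ∣ y ∣)

parityℤ-sign : ∀ i → parityℤ (sign i) ≡ 1ℙ
parityℤ-sign zero = refl
parityℤ-sign (suc zero) = refl
parityℤ-sign (suc (suc i)) = parityℤ-sign i

parityℤ-sumFin : ∀ n (g : Fin n → ℤ) → parityℤ (sumFin n g) ≡ sum (parityℤ ∘ g)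
parityℤ-sumFin zero g = refl
parityℤ-sumFin (suc n) g =
  trans (parityℤ-+ (g zero) _) (cong (parityℤ (g zero) ⊕_) (parityℤ-sumFin n (g ∘ suc)))

2∣-parity : ∀ n → parity n ≡ 0ℙ → 2 ℕᵈ.∣ n
2∣-parity zero _ = divides 0 refl
2∣-parity (suc zero) ()
2∣-parity (suc (suc n)) e with 2∣-parity n e
... | divides q n≡q*2 = divides (suc q) (cong (λ k → suc (suc k)) n≡q*2)

2∣-parityℤ : ∀ x → parityℤ x ≡ 0ℙ → + 2 ∣ x
2∣-parityℤ x = 2∣-parity ∣ x ∣

2∣-1-parityℤ : ∀ x → parityℤ x ≡ 1ℙ → + 2 ∣ x - + 1
2∣-1-parityℤ x e = 2∣-parityℤ (x - + 1) (begin
  parityℤ (x - + 1)          ≡⟨ parityℤ-+ x -[1+ 0 ] ⟩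
  parityℤ x ⊕ 1ℙ             ≡⟨ cong (_⊕ 1ℙ) e ⟩
  0ℙ                         ∎)
  where open ≡-Reasoning

-- Determinants over 𝔽₂

Matrix : ℕ → Set
Matrix n = Fin n → Fin n → Parity

_ᵀ : ∀ {n} → Matrix n → Matrix n
(M ᵀ) r c = M c r

minor : ∀ {n} → Fin (suc n) → Matrix (suc n) → Matrix n
minor j M r c = M (suc r) (punchIn j c)

det₂ : ∀ n → Matrix n → Parity
det₂ zero    M = 1ℙ
det₂ (suc n) M = sum λ j → M zero j · det₂ n (minor j M)

det₂ᶜ : ∀ n → Matrix n → Parity
det₂ᶜ zero    M = 1ℙ
det₂ᶜ (suc n) M = sum λ i → M i zero · det₂ᶜ n (λ r c → M (punchIn i r) (suc c))

parityℤ-det : ∀ n (M : Fin n → Fin n → ℤ) → parityℤ (det n M) ≡ det₂ n (λ r c → parityℤ (M r c))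
parityℤ-det zero M = refl
parityℤ-det (suc n) M = trans (parityℤ-sumFin (suc n) expansion) (sum-cong-≗ term)
  where
  M₂ : Matrix (suc n)
  M₂ r c = parityℤ (M r c)
  expansion : Fin (suc n) → ℤ
  expansion j = sign (toℕ j) ℤ.* M zero j ℤ.* det n (λ r c → M (suc r) (punchIn j c))
  term : ∀ j → parityℤ (expansion j) ≡ M₂ zero j · det₂ n (minor j M₂)
  term j = begin
    parityℤ (s ℤ.* M zero j ℤ.* d)           ≡⟨ parityℤ-* (s ℤ.* M zero j) d ⟩
    parityℤ (s ℤ.* M zero j) · parityℤ d     ≡⟨ cong (_· parityℤ d) (parityℤ-* s (M zero j)) ⟩
    parityℤ s · M₂ zero j · parityℤ d        ≡⟨ cong (λ p → p · M₂ zero j · parityℤ d) (parityℤ-sign (toℕ j)) ⟩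
    M₂ zero j · parityℤ d                    ≡⟨ cong (M₂ zero j ·_) (parityℤ-det n _) ⟩
    M₂ zero j · det₂ n (minor j M₂)          ∎
    where
    open ≡-Reasoning
    s = sign (toℕ j)
    d = det n (λ r c → M (suc r) (punchIn j c))

det₂-cong : ∀ n {M N : Matrix n} → (∀ r c → M r c ≡ N r c) → det₂ n M ≡ det₂ n N
det₂-cong zero    M≡N = refl
det₂-cong (suc n) M≡N = sum-cong-≗ λ j →
  cong₂ _·_ (M≡N zero j) (det₂-cong n (λ r c → M≡N (suc r) (punchIn j c)))

det₂ᶜ≡det₂ᵀ : ∀ n (M : Matrix n) → det₂ᶜ n M ≡ det₂ n (M ᵀ)
det₂ᶜ≡det₂ᵀ zero    M = refl
det₂ᶜ≡det₂ᵀ (suc n) M = sum-cong-≗ λ i → cong (M i zero ·_) (det₂ᶜ≡det₂ᵀ n (λ r c → M (punchIn i r) (suc c)))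

-- Both sides expand to the same double sum over the entries of the first row and first column.
det₂≡det₂ᶜ : ∀ n (M : Matrix n) → det₂ n M ≡ det₂ᶜ n M
det₂≡det₂ᶜ zero          M = refl
det₂≡det₂ᶜ (suc zero)    M = refl
det₂≡det₂ᶜ (suc (suc n)) M =
  cong₂ _⊕_ (cong (M zero zero ·_) (det₂≡det₂ᶜ (suc n) (minor zero M))) (begin
    sum (λ j → M zero (suc j) · det₂ (suc n) (minor (suc j) M))
      ≡⟨ sum-cong-≗ (λ j → cong (M zero (suc j) ·_) (trans (det₂≡det₂ᶜ (suc n) (minor (suc j) M))
           (sum-cong-≗ λ i → cong (M (suc i) zero ·_) (sym (det₂≡det₂ᶜ n (λ r c → M (suc (punchIn i r)) (suc (punchIn j c)))))))) ⟩
    sum (λ j → M zero (suc j) · sum (λ i → M (suc i) zero · X i j))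
      ≡⟨ sum-cong-≗ (λ j → *-distribˡ-sum (M zero (suc j)) (λ i → M (suc i) zero · X i j)) ⟩
    sum (λ j → sum (λ i → M zero (suc j) · (M (suc i) zero · X i j)))
      ≡⟨ ∑-comm (λ j i → M zero (suc j) · (M (suc i) zero · X i j)) ⟩
    sum (λ i → sum (λ j → M zero (suc j) · (M (suc i) zero · X i j)))
      ≡⟨ sum-cong-≗ (λ i → sum-cong-≗ λ j → ·-swapˡ (M zero (suc j)) (M (suc i) zero) (X i j)) ⟩
    sum (λ i → sum (λ j → M (suc i) zero · (M zero (suc j) · X i j)))
      ≡⟨ sum-cong-≗ (λ i → *-distribˡ-sum (M (suc i) zero) (λ j → M zero (suc j) · X i j)) ⟨
    sum (λ i → M (suc i) zero · sum (λ j → M zero (suc j) · X i j))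
      ≡⟨ sum-cong-≗ (λ i → cong (M (suc i) zero ·_) (det₂≡det₂ᶜ (suc n) (λ r c → M (punchIn (suc i) r) (suc c)))) ⟩
    sum (λ i → M (suc i) zero · det₂ᶜ (suc n) (λ r c → M (punchIn (suc i) r) (suc c))) ∎)
  where
  open ≡-Reasoning
  X : Fin (suc n) → Fin (suc n) → Parity
  X i j = det₂ n (λ r c → M (suc (punchIn i r)) (suc (punchIn j c)))

det₂-ᵀ : ∀ n (M : Matrix n) → det₂ n (M ᵀ) ≡ det₂ n M
det₂-ᵀ n M = sym (trans (det₂≡det₂ᶜ n M) (det₂ᶜ≡det₂ᵀ n M))

SameRowsExcept : ∀ {n} → Fin n → Matrix n → Matrix n → Set
SameRowsExcept r M N = ∀ i → i ≢ r → ∀ c → M i c ≡ N i c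

minor-sameRowsExcept : ∀ {n} {M N : Matrix (suc n)} r j →
  SameRowsExcept (suc r) M N → SameRowsExcept r (minor j M) (minor j N)
minor-sameRowsExcept r j M≈N i i≢r c = M≈N (suc i) (i≢r ∘ suc-injective) (punchIn j c)

det₂-linear : ∀ n (M A B : Matrix n) r → (∀ c → M r c ≡ A r c ⊕ B r c) →
  SameRowsExcept r A M → SameRowsExcept r B M → det₂ n M ≡ det₂ n A ⊕ det₂ n B
det₂-linear (suc n) M A B zero Mr A≈M B≈M = begin
  sum (λ j → M zero j · d j)
    ≡⟨ sum-cong-≗ (λ j → trans (cong (_· d j) (Mr j)) (Parityₚ.*-distribʳ-+ (d j) (A zero j) (B zero j))) ⟩
  sum (λ j → A zero j · d j ⊕ B zero j · d j)
    ≡⟨ ∑-distrib-+ (λ j → A zero j · d j) (λ j → B zero j · d j) ⟩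
  sum (λ j → A zero j · d j) ⊕ sum (λ j → B zero j · d j)
    ≡⟨ cong₂ _⊕_ (sum-cong-≗ λ j → cong (A zero j ·_) (det₂-cong n (λ r c → sym (A≈M (suc r) (λ ()) (punchIn j c)))))
                 (sum-cong-≗ λ j → cong (B zero j ·_) (det₂-cong n (λ r c → sym (B≈M (suc r) (λ ()) (punchIn j c))))) ⟩
  det₂ (suc n) A ⊕ det₂ (suc n) B ∎
  where
  open ≡-Reasoning
  d : Fin (suc n) → Parity
  d j = det₂ n (minor j M)
det₂-linear (suc n) M A B (suc r) Mr A≈M B≈M = begin
  sum (λ j → M zero j · det₂ n (minor j M))
    ≡⟨ sum-cong-≗ (λ j → trans (cong (M zero j ·_) (det₂-linear n (minor j M) (minor j A) (minor j B) r
         (λ c → Mr (punchIn j c)) (minor-sameRowsExcept r j A≈M) (minor-sameRowsExcept r j B≈M)))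
         (Parityₚ.*-distribˡ-+ (M zero j) (det₂ n (minor j A)) (det₂ n (minor j B)))) ⟩
  sum (λ j → M zero j · det₂ n (minor j A) ⊕ M zero j · det₂ n (minor j B))
    ≡⟨ ∑-distrib-+ (λ j → M zero j · det₂ n (minor j A)) (λ j → M zero j · det₂ n (minor j B)) ⟩
  sum (λ j → M zero j · det₂ n (minor j A)) ⊕ sum (λ j → M zero j · det₂ n (minor j B))
    ≡⟨ cong₂ _⊕_ (sum-cong-≗ λ j → cong (_· det₂ n (minor j A)) (sym (A≈M zero (λ ()) j)))
                 (sum-cong-≗ λ j → cong (_· det₂ n (minor j B)) (sym (B≈M zero (λ ()) j))) ⟩
  det₂ (suc n) A ⊕ det₂ (suc n) B ∎
  where open ≡-Reasoning

det₂-scale : ∀ n (M A : Matrix n) r a → (∀ c → M r c ≡ a · A r c) →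
  SameRowsExcept r A M → det₂ n M ≡ a · det₂ n A
det₂-scale (suc n) M A zero a Mr A≈M = begin
  sum (λ j → M zero j · det₂ n (minor j M))
    ≡⟨ sum-cong-≗ (λ j → cong₂ _·_ (Mr j) (det₂-cong n (λ r c → sym (A≈M (suc r) (λ ()) (punchIn j c))))) ⟩
  sum (λ j → a · A zero j · det₂ n (minor j A))
    ≡⟨ sum-cong-≗ (λ j → Parityₚ.*-assoc a (A zero j) (det₂ n (minor j A))) ⟩
  sum (λ j → a · (A zero j · det₂ n (minor j A)))
    ≡⟨ *-distribˡ-sum a (λ j → A zero j · det₂ n (minor j A)) ⟨
  a · det₂ (suc n) A ∎
  where open ≡-Reasoning
det₂-scale (suc n) M A (suc r) a Mr A≈M = begin
  sum (λ j → M zero j · det₂ n (minor j M))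
    ≡⟨ sum-cong-≗ (λ j → cong₂ _·_ (sym (A≈M zero (λ ()) j))
         (det₂-scale n (minor j M) (minor j A) r a (λ c → Mr (punchIn j c)) (minor-sameRowsExcept r j A≈M))) ⟩
  sum (λ j → A zero j · (a · det₂ n (minor j A)))
    ≡⟨ sum-cong-≗ (λ j → ·-swapˡ (A zero j) a (det₂ n (minor j A))) ⟩
  sum (λ j → a · (A zero j · det₂ n (minor j A)))
    ≡⟨ *-distribˡ-sum a (λ j → A zero j · det₂ n (minor j A)) ⟨
  a · det₂ (suc n) A ∎
  where open ≡-Reasoning

det₂-zeroRow : ∀ n (M : Matrix n) r → (∀ c → M r c ≡ 0ℙ) → det₂ n M ≡ 0ℙ
det₂-zeroRow n M r Mr≡0 = det₂-scale n M M r 0ℙ Mr≡0 (λ _ _ _ → refl)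

-- punchOut without the side condition i ≢ j; the value at i = j is never inspected.
punchOut′ : ∀ {n} → Fin (suc (suc n)) → Fin (suc (suc n)) → Fin (suc n)
punchOut′ zero zero = zero
punchOut′ zero (suc j) = j
punchOut′ (suc i) zero = zero
punchOut′ {suc n} (suc i) (suc j) = suc (punchOut′ i j)
punchOut′ {zero} (suc i) (suc j) = zero

punchOut′-punchIn : ∀ {n} (j : Fin (suc (suc n))) k → punchOut′ j (punchIn j k) ≡ k
punchOut′-punchIn zero k = refl
punchOut′-punchIn (suc j) zero = refl
punchOut′-punchIn {suc n} (suc j) (suc k) = cong suc (punchOut′-punchIn j k)

punchIn-punchIn-comm : ∀ {n} (i j : Fin (suc (suc n))) → i ≢ j → ∀ c →
  punchIn i (punchIn (punchOut′ i j) c) ≡ punchIn j (punchIn (punchOut′ j i) c)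
punchIn-punchIn-comm zero zero i≢j c = ⊥-elim (i≢j refl)
punchIn-punchIn-comm zero (suc j) i≢j c = refl
punchIn-punchIn-comm (suc i) zero i≢j c = refl
punchIn-punchIn-comm {suc n} (suc i) (suc j) i≢j zero = refl
punchIn-punchIn-comm {suc n} (suc i) (suc j) i≢j (suc c) =
  cong suc (punchIn-punchIn-comm i j (i≢j ∘ cong suc) c)

-- Expanding along rows 0 and 1 gives Σ_{j ≠ j'} M₀ⱼ M₀ⱼ' W j j' with W symmetric, so every
-- term occurs twice.
det₂-equalRows₀₁ : ∀ n (M : Matrix (suc (suc n))) → (∀ c → M zero c ≡ M (suc zero) c) →
  det₂ (suc (suc n)) M ≡ 0ℙ
det₂-equalRows₀₁ n M M₀≡M₁ = begin
  sum (λ j → M zero j · det₂ (suc n) (minor j M))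
    ≡⟨ sum-cong-≗ expand ⟩
  sum (λ j → F j j ⊕ sum (F j))
    ≡⟨ ∑-distrib-+ (λ j → F j j) (λ j → sum (F j)) ⟩
  sum (λ j → F j j) ⊕ sum (λ j → sum (F j))
    ≡⟨ cong (sum (λ j → F j j) ⊕_) (sum-symmetric (suc (suc n)) F F-sym) ⟩
  sum (λ j → F j j) ⊕ sum (λ j → F j j)
    ≡⟨ Parityₚ.p+p≡0ℙ (sum (λ j → F j j)) ⟩
  0ℙ ∎
  where
  open ≡-Reasoning
  W : Fin (suc (suc n)) → Fin (suc (suc n)) → Parity
  W j j' = det₂ n (λ r c → M (suc (suc r)) (punchIn j (punchIn (punchOut′ j j') c)))
  F : Fin (suc (suc n)) → Fin (suc (suc n)) → Parity
  F j j' = M zero j · (M zero j' · W j j')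
  F-sym : ∀ j j' → F j j' ≡ F j' j
  F-sym j j' with j ≟ j'
  ... | yes refl = refl
  ... | no j≢j' = trans (·-swapˡ (M zero j) (M zero j') (W j j'))
        (cong (λ w → M zero j' · (M zero j · w))
              (det₂-cong n (λ r c → cong (M (suc (suc r))) (punchIn-punchIn-comm j j' j≢j' c))))
  expand : ∀ j → M zero j · det₂ (suc n) (minor j M) ≡ F j j ⊕ sum (F j)
  expand j = begin
    M zero j · sum (λ k → M (suc zero) (punchIn j k) · det₂ n (minor k (minor j M)))
      ≡⟨ cong (M zero j ·_) (sum-cong-≗ λ k → cong₂ _·_ (sym (M₀≡M₁ (punchIn j k)))
           (det₂-cong n (λ r c → cong (λ z → M (suc (suc r)) (punchIn j (punchIn z c))) (sym (punchOut′-punchIn j k))))) ⟩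
    M zero j · sum (λ k → M zero (punchIn j k) · W j (punchIn j k))
      ≡⟨ *-distribˡ-sum (M zero j) (λ k → M zero (punchIn j k) · W j (punchIn j k)) ⟩
    sum (λ k → F j (punchIn j k))
      ≡⟨ ⊕-moveˡ {x = sum (F j)} {a = F j j} (sum-remove {i = j} (F j)) ⟩
    F j j ⊕ sum (F j) ∎

setRow : ∀ {n} → Matrix n → Fin n → (Fin n → Parity) → Matrix n
setRow M r x = updateAt M r (λ _ → x)

setRow-≡ : ∀ {n} (M : Matrix n) r x c → setRow M r x r c ≡ x c
setRow-≡ M r x c = cong-app (updateAt-updates r M) c

setRow-≢ : ∀ {n} (M : Matrix n) r x i → i ≢ r → ∀ c → setRow M r x i c ≡ M i c
setRow-≢ M r x i i≢r c = cong-app (updateAt-minimal i r M i≢r) c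

setRow-sameRowsExcept : ∀ {n} (M : Matrix n) r x y → SameRowsExcept r (setRow M r x) (setRow M r y)
setRow-sameRowsExcept M r x y i i≢r c = trans (setRow-≢ M r x i i≢r c) (sym (setRow-≢ M r y i i≢r c))

setRow-self : ∀ {n} (M : Matrix n) r i c → setRow M r (M r) i c ≡ M i c
setRow-self M r i c with i ≟ r
... | yes refl = setRow-≡ M r (M r) c
... | no i≢r = setRow-≢ M r (M r) i i≢r c

Alternating : ℕ → Set
Alternating n = ∀ (M : Matrix n) i j → i ≢ j → (∀ c → M i c ≡ M j c) → det₂ n M ≡ 0ℙ

IsRowSwap : ∀ {n} → Fin n → Fin n → Matrix n → Matrix n → Set
IsRowSwap i j M N = (∀ c → N i c ≡ M j c) × (∀ c → N j c ≡ M i c) × (∀ k → k ≢ i → k ≢ j → ∀ c → N k c ≡ M k c)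

module TwoRows {n} (M : Matrix n) {i j : Fin n} (i≢j : i ≢ j) where

  G : (Fin n → Parity) → (Fin n → Parity) → Matrix n
  G x y = setRow (setRow M i x) j y

  G-i : ∀ x y c → G x y i c ≡ x c
  G-i x y c = trans (setRow-≢ (setRow M i x) j y i i≢j c) (setRow-≡ M i x c)

  G-j : ∀ x y c → G x y j c ≡ y c
  G-j x y c = setRow-≡ (setRow M i x) j y c

  G-k : ∀ x y k → k ≢ i → k ≢ j → ∀ c → G x y k c ≡ M k c
  G-k x y k k≢i k≢j c = trans (setRow-≢ (setRow M i x) j y k k≢j c) (setRow-≢ M i x k k≢i c)

  G-sameRowsExcept-i : ∀ x x' y → SameRowsExcept i (G x y) (G x' y)
  G-sameRowsExcept-i x x' y k k≢i c with k ≟ j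
  ... | yes refl = trans (G-j x y c) (sym (G-j x' y c))
  ... | no k≢j = trans (G-k x y k k≢i k≢j c) (sym (G-k x' y k k≢i k≢j c))

  G-sameRowsExcept-j : ∀ x y y' → SameRowsExcept j (G x y) (G x y')
  G-sameRowsExcept-j x y y' k k≢j c with k ≟ i
  ... | yes refl = trans (G-i x y c) (sym (G-i x y' c))
  ... | no k≢i = trans (G-k x y k k≢i k≢j c) (sym (G-k x y' k k≢i k≢j c))

  G-swap : ∀ N → IsRowSwap i j M N → ∀ k c → G (M j) (M i) k c ≡ N k c
  G-swap N (Ni , Nj , Nk) k c with k ≟ i | k ≟ j
  ... | yes refl | _ = trans (G-i (M j) (M i) c) (sym (Ni c))
  ... | no _ | yes refl = trans (G-j (M j) (M i) c) (sym (Nj c))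
  ... | no k≢i | no k≢j = trans (G-k (M j) (M i) k k≢i k≢j c) (sym (Nk k k≢i k≢j c))

  G-self : ∀ k c → G (M i) (M j) k c ≡ M k c
  G-self k c with k ≟ i | k ≟ j
  ... | yes refl | _ = G-i (M i) (M j) c
  ... | no _ | yes refl = G-j (M i) (M j) c
  ... | no k≢i | no k≢j = G-k (M i) (M j) k k≢i k≢j c

  det₂-G-⊕ˡ : ∀ x x' y → det₂ n (G (λ c → x c ⊕ x' c) y) ≡ det₂ n (G x y) ⊕ det₂ n (G x' y)
  det₂-G-⊕ˡ x x' y = det₂-linear n _ (G x y) (G x' y) i
    (λ c → trans (G-i _ y c) (sym (cong₂ _⊕_ (G-i x y c) (G-i x' y c))))
    (G-sameRowsExcept-i x _ y) (G-sameRowsExcept-i x' _ y)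

  det₂-G-⊕ʳ : ∀ x y y' → det₂ n (G x (λ c → y c ⊕ y' c)) ≡ det₂ n (G x y) ⊕ det₂ n (G x y')
  det₂-G-⊕ʳ x y y' = det₂-linear n _ (G x y) (G x y') j
    (λ c → trans (G-j x _ c) (sym (cong₂ _⊕_ (G-j x y c) (G-j x y' c))))
    (G-sameRowsExcept-j x y _) (G-sameRowsExcept-j x y' _)

-- Expand det₂ (G s s) = 0 for s = Mᵢ + Mⱼ by bilinearity; over 𝔽₂ the sign of a swap is invisible.
det₂-swapRows : ∀ n → Alternating n → ∀ (M N : Matrix n) {i j} → i ≢ j → IsRowSwap i j M N →
  det₂ n N ≡ det₂ n M
det₂-swapRows n alt M N {i} {j} i≢j swap = sym (⊕-cancel (det₂ n M) (det₂ n N) (begin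
  det₂ n M ⊕ det₂ n N
    ≡⟨ cong₂ _⊕_ (det₂-cong n G-self) (det₂-cong n (G-swap N swap)) ⟨
  det₂ n (G Mi Mj) ⊕ det₂ n (G Mj Mi)
    ≡⟨ cong₂ _⊕_ (cong (_⊕ det₂ n (G Mi Mj)) (same Mi))
                 (trans (cong (det₂ n (G Mj Mi) ⊕_) (same Mj)) (Parityₚ.+-identityʳ (det₂ n (G Mj Mi)))) ⟨
  (det₂ n (G Mi Mi) ⊕ det₂ n (G Mi Mj)) ⊕ (det₂ n (G Mj Mi) ⊕ det₂ n (G Mj Mj))
    ≡⟨ cong₂ _⊕_ (det₂-G-⊕ʳ Mi Mi Mj) (det₂-G-⊕ʳ Mj Mi Mj) ⟨
  det₂ n (G Mi s) ⊕ det₂ n (G Mj s)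
    ≡⟨ det₂-G-⊕ˡ Mi Mj s ⟨
  det₂ n (G s s)
    ≡⟨ same s ⟩
  0ℙ ∎))
  where
  open ≡-Reasoning
  open TwoRows M i≢j
  Mi = M i
  Mj = M j
  s : Fin n → Parity
  s c = Mi c ⊕ Mj c
  same : ∀ x → det₂ n (G x x) ≡ 0ℙ
  same x = alt (G x x) i j i≢j (λ c → trans (G-i x x c) (sym (G-j x x c)))

-- Equal rows 0 and j + 2: swapping rows 1 and j + 2 changes no minor along row 0 (by the
-- alternating property one size down) and produces equal rows 0 and 1.
det₂-equalRows₀ : ∀ n → Alternating (suc n) → ∀ (M : Matrix (suc (suc n))) (j : Fin n) →
  (∀ c → M zero c ≡ M (suc (suc j)) c) → det₂ (suc (suc n)) M ≡ 0ℙ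
det₂-equalRows₀ n alt M j M₀≡Mⱼ = trans (sym (sum-cong-≗ sameTerm)) (det₂-equalRows₀₁ n M′ M′₀≡M′₁)
  where
  one≢j+2 : suc zero ≢ suc (suc j)
  one≢j+2 ()
  open TwoRows M one≢j+2
  Mⱼ = M (suc (suc j))
  M₁ = M (suc zero)
  M′ = G Mⱼ M₁
  M′₀≡M′₁ : ∀ c → M′ zero c ≡ M′ (suc zero) c
  M′₀≡M′₁ c = trans (G-k Mⱼ M₁ zero (λ ()) (λ ()) c) (trans (M₀≡Mⱼ c) (sym (G-i Mⱼ M₁ c)))
  sameTerm : ∀ k → M′ zero k · det₂ (suc n) (minor k M′) ≡ M zero k · det₂ (suc n) (minor k M)
  sameTerm k = cong₂ _·_ (G-k Mⱼ M₁ zero (λ ()) (λ ()) k)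
    (det₂-swapRows (suc n) alt (minor k M) (minor k M′) {zero} {suc j} (λ ())
      ( (λ c → G-i Mⱼ M₁ (punchIn k c))
      , (λ c → G-j Mⱼ M₁ (punchIn k c))
      , (λ k′ k′≢0 k′≢j c → G-k Mⱼ M₁ (suc k′) (k′≢0 ∘ suc-injective) (k′≢j ∘ suc-injective) (punchIn k c))))

det₂-alternating : ∀ n → Alternating n
det₂-alternating (suc n) M zero zero i≢j _ = ⊥-elim (i≢j refl)
det₂-alternating (suc n) M (suc i) (suc j) i≢j Mᵢ≡Mⱼ = sum-zero _ λ k →
  trans (cong (M zero k ·_) (det₂-alternating n (minor k M) i j (i≢j ∘ cong suc) (Mᵢ≡Mⱼ ∘ punchIn k)))
        (Parityₚ.*-zeroʳ (M zero k))
det₂-alternating (suc (suc n)) M zero (suc zero) _ M₀≡M₁ = det₂-equalRows₀₁ n M M₀≡M₁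
det₂-alternating (suc (suc n)) M (suc zero) zero _ M₁≡M₀ = det₂-equalRows₀₁ n M (sym ∘ M₁≡M₀)
det₂-alternating (suc (suc n)) M zero (suc (suc j)) _ M₀≡Mⱼ =
  det₂-equalRows₀ n (det₂-alternating (suc n)) M j M₀≡Mⱼ
det₂-alternating (suc (suc n)) M (suc (suc i)) zero _ Mᵢ≡M₀ =
  det₂-equalRows₀ n (det₂-alternating (suc n)) M i (sym ∘ Mᵢ≡M₀)

det₂-setRow-sum : ∀ n m (M : Matrix n) r (rows : Fin m → Fin n → Parity) →
  det₂ n (setRow M r (λ c → sum (λ p → rows p c))) ≡ sum (λ p → det₂ n (setRow M r (rows p)))
det₂-setRow-sum n zero M r rows = det₂-zeroRow n _ r (setRow-≡ M r _)
det₂-setRow-sum n (suc m) M r rows = trans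
  (det₂-linear n _ (setRow M r (rows zero)) (setRow M r (λ c → sum (λ p → rows (suc p) c))) r
    (λ c → trans (setRow-≡ M r _ c) (sym (cong₂ _⊕_ (setRow-≡ M r _ c) (setRow-≡ M r _ c))))
    (setRow-sameRowsExcept M r _ _) (setRow-sameRowsExcept M r _ _))
  (cong (det₂ n (setRow M r (rows zero)) ⊕_) (det₂-setRow-sum n m M r (rows ∘ suc)))

det₂-addRowCombination : ∀ n (M : Matrix n) r (g : Fin n → Parity) → g r ≡ 0ℙ →
  det₂ n (setRow M r (λ c → M r c ⊕ sum (λ p → g p · M p c))) ≡ det₂ n M
det₂-addRowCombination n M r g gᵣ≡0 = begin
  det₂ n (setRow M r (λ c → M r c ⊕ comb c))
    ≡⟨ det₂-linear n _ (setRow M r (M r)) (setRow M r comb) r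
         (λ c → trans (setRow-≡ M r _ c) (sym (cong₂ _⊕_ (setRow-≡ M r _ c) (setRow-≡ M r _ c))))
         (setRow-sameRowsExcept M r _ _) (setRow-sameRowsExcept M r _ _) ⟩
  det₂ n (setRow M r (M r)) ⊕ det₂ n (setRow M r comb)
    ≡⟨ cong₂ _⊕_ (det₂-cong n (setRow-self M r)) (det₂-setRow-sum n n M r (λ p c → g p · M p c)) ⟩
  det₂ n M ⊕ sum (λ p → det₂ n (setRow M r (λ c → g p · M p c)))
    ≡⟨ cong (det₂ n M ⊕_) (sum-zero _ vanishes) ⟩
  det₂ n M ⊕ 0ℙ
    ≡⟨ Parityₚ.+-identityʳ (det₂ n M) ⟩
  det₂ n M ∎
  where
  open ≡-Reasoning
  comb : Fin n → Parity
  comb c = sum (λ p → g p · M p c)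
  vanishes : ∀ p → det₂ n (setRow M r (λ c → g p · M p c)) ≡ 0ℙ
  vanishes p = trans
    (det₂-scale n _ (setRow M r (M p)) r (g p)
      (λ c → trans (setRow-≡ M r _ c) (cong (g p ·_) (sym (setRow-≡ M r _ c))))
      (setRow-sameRowsExcept M r _ _))
    (twoEqualRows (p ≟ r))
    where
    twoEqualRows : Dec (p ≡ r) → g p · det₂ n (setRow M r (M p)) ≡ 0ℙ
    twoEqualRows (yes refl) = cong (_· det₂ n (setRow M r (M p))) gᵣ≡0
    twoEqualRows (no p≢r) = trans
      (cong (g p ·_) (det₂-alternating n (setRow M r (M p)) r p (p≢r ∘ sym)
        (λ c → trans (setRow-≡ M r _ c) (sym (setRow-≢ M r _ p p≢r c)))))
      (Parityₚ.*-zeroʳ (g p))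

infixl 7 _*ᴹ_
_*ᴹ_ : ∀ {n} → Matrix n → Matrix n → Matrix n
(A *ᴹ B) i c = sum (λ p → A i p · B p c)

IsUnitLowerTriangular : ∀ {n} → Matrix n → Set
IsUnitLowerTriangular L = (∀ i → L i i ≡ 1ℙ) × (∀ i k → toℕ i < toℕ k → L i k ≡ 0ℙ)

-- Z k agrees with X on the rows above k and with L X from row k on; passing from Z (k + 1)
-- to Z k adds to row k a combination of the rows above it.
module UnitLowerProduct {n} (L X : Matrix n) (L-unit : IsUnitLowerTriangular L) where

  Z : ℕ → Matrix n
  Z k i with toℕ i <? k
  ... | yes _ = X i
  ... | no _ = (L *ᴹ X) i

  Z-above : ∀ k i c → toℕ i < k → Z k i c ≡ X i c
  Z-above k i c i<k with toℕ i <? k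
  ... | yes _ = refl
  ... | no i≮k = ⊥-elim (i≮k i<k)

  Z-below : ∀ k i c → ¬ toℕ i < k → Z k i c ≡ (L *ᴹ X) i c
  Z-below k i c i≮k with toℕ i <? k
  ... | yes i<k = ⊥-elim (i≮k i<k)
  ... | no _ = refl

  det₂-Z-step : ∀ k (k<n : k < n) → det₂ n (Z k) ≡ det₂ n (Z (suc k))
  det₂-Z-step k k<n = trans (det₂-cong n Zk≡) (det₂-addRowCombination n (Z (suc k)) r g gᵣ≡0)
    where
    r = fromℕ< k<n
    r≡k : toℕ r ≡ k
    r≡k = toℕ-fromℕ< k<n
    g : Fin n → Parity
    g p with p ≟ r
    ... | yes _ = 0ℙ
    ... | no _ = L r p
    gᵣ≡0 : g r ≡ 0ℙ
    gᵣ≡0 with r ≟ r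
    ... | yes _ = refl
    ... | no r≢r = ⊥-elim (r≢r refl)
    g≡L : ∀ p → p ≢ r → g p ≡ L r p
    g≡L p p≢r with p ≟ r
    ... | yes p≡r = ⊥-elim (p≢r p≡r)
    ... | no _ = refl
    g-below : ∀ p → ¬ toℕ p < suc k → g p ≡ 0ℙ
    g-below p p≮k+1 with p ≟ r
    ... | yes _ = refl
    ... | no _ = proj₂ L-unit r p (subst (_< toℕ p) (sym r≡k) (≮⇒≥ p≮k+1))
    g·Z≡g·X : ∀ p c → g p · Z (suc k) p c ≡ g p · X p c
    g·Z≡g·X p c = byPosition (toℕ p <? suc k)
      where
      byPosition : Dec (toℕ p < suc k) → g p · Z (suc k) p c ≡ g p · X p c
      byPosition (yes p<k+1) = cong (g p ·_) (Z-above (suc k) p c p<k+1)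
      byPosition (no p≮k+1) = trans (cong (_· Z (suc k) p c) (g-below p p≮k+1)) (sym (cong (_· X p c) (g-below p p≮k+1)))
    LXᵣ : ∀ c → (L *ᴹ X) r c ≡ X r c ⊕ sum (λ p → g p · X p c)
    LXᵣ c = trans (sum-except _ _ r (cong (_· X r c) gᵣ≡0) (λ p p≢r → cong (_· X p c) (sym (g≡L p p≢r))))
                  (cong (_⊕ sum (λ p → g p · X p c)) (cong (_· X r c) (proj₁ L-unit r)))
    Zk≡ : ∀ i c → Z k i c ≡ setRow (Z (suc k)) r (λ c → Z (suc k) r c ⊕ sum (λ p → g p · Z (suc k) p c)) i c
    Zk≡ i c with i ≟ r
    ... | yes refl = trans (Z-below k r c (<-irrefl r≡k)) (trans (LXᵣ c) (sym (trans (setRow-≡ (Z (suc k)) r _ c)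
            (cong₂ _⊕_ (Z-above (suc k) r c (subst (_< suc k) (sym r≡k) ≤-refl)) (sum-cong-≗ λ p → g·Z≡g·X p c)))))
    ... | no i≢r = trans (unchanged (toℕ i <? k)) (sym (setRow-≢ (Z (suc k)) r _ i i≢r c))
      where
      i≢k : toℕ i ≢ k
      i≢k e = i≢r (toℕ-injective (trans e (sym r≡k)))
      unchanged : Dec (toℕ i < k) → Z k i c ≡ Z (suc k) i c
      unchanged (yes i<k) = trans (Z-above k i c i<k) (sym (Z-above (suc k) i c (s≤s (<⇒≤ i<k))))
      unchanged (no i≮k) = trans (Z-below k i c i≮k) (sym (Z-below (suc k) i c (λ i<k+1 → i≮k (≤∧≢⇒< (m<1+n⇒m≤n i<k+1) i≢k))))

  det₂-Z : ∀ k → k ≤ n → det₂ n (Z 0) ≡ det₂ n (Z k)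
  det₂-Z zero _ = refl
  det₂-Z (suc k) k<n = trans (det₂-Z k (<⇒≤ k<n)) (det₂-Z-step k k<n)

det₂-unitLower-* : ∀ n (L X : Matrix n) → IsUnitLowerTriangular L → det₂ n (L *ᴹ X) ≡ det₂ n X
det₂-unitLower-* n L X L-unit = begin
  det₂ n (L *ᴹ X) ≡⟨ det₂-cong n (λ i c → Z-below 0 i c (λ ())) ⟨
  det₂ n (Z 0)    ≡⟨ det₂-Z n ≤-refl ⟩
  det₂ n (Z n)    ≡⟨ det₂-cong n (λ i c → Z-above n i c (toℕ<n i)) ⟩
  det₂ n X        ∎
  where
  open ≡-Reasoning
  open UnitLowerProduct L X L-unit

sumBelow : ℕ → (ℕ → Parity) → Parity
sumBelow n g = sum {n} (g ∘ toℕ)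

sumBelow-cong : ∀ n {g h : ℕ → Parity} → (∀ i → i < n → g i ≡ h i) → sumBelow n g ≡ sumBelow n h
sumBelow-cong n g≡h = sum-cong-≗ λ i → g≡h (toℕ i) (toℕ<n i)

sumBelow-zero : ∀ n (g : ℕ → Parity) → (∀ i → i < n → g i ≡ 0ℙ) → sumBelow n g ≡ 0ℙ
sumBelow-zero n g g≡0 = sum-zero (g ∘ toℕ) λ i → g≡0 (toℕ i) (toℕ<n i)

sumBelow-suc : ∀ n (g : ℕ → Parity) → sumBelow (suc n) g ≡ sumBelow n g ⊕ g n
sumBelow-suc n g = trans (sum-init-last {n} (g ∘ toℕ))
  (cong₂ _⊕_ (sum-cong-≗ {n} λ i → cong g (toℕ-inject₁ i)) (cong g (toℕ-fromℕ n)))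

sumBelow-suc-zero : ∀ N (g : ℕ → Parity) → g N ≡ 0ℙ → sumBelow (suc N) g ≡ sumBelow N g
sumBelow-suc-zero N g g≡0 = trans (sumBelow-suc N g) (trans (cong (sumBelow N g ⊕_) g≡0) (Parityₚ.+-identityʳ _))

sumBelow-extend : ∀ m k (g : ℕ → Parity) → (∀ i → m ≤ i → g i ≡ 0ℙ) → sumBelow (m + k) g ≡ sumBelow m g
sumBelow-extend zero k g g≡0 = sumBelow-zero k g λ i _ → g≡0 i z≤n
sumBelow-extend (suc m) k g g≡0 = cong (g 0 ⊕_) (sumBelow-extend m k (g ∘ suc) λ i m≤i → g≡0 (suc i) (s≤s m≤i))

sumBelow-support : ∀ m n n′ (g : ℕ → Parity) → m ≤ n → m ≤ n′ → (∀ i → m ≤ i → g i ≡ 0ℙ) →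
  sumBelow n g ≡ sumBelow n′ g
sumBelow-support m n n′ g m≤n m≤n′ g≡0 = begin
  sumBelow n g             ≡⟨ cong (λ z → sumBelow z g) (m+[n∸m]≡n m≤n) ⟨
  sumBelow (m + (n ∸ m)) g   ≡⟨ sumBelow-extend m (n ∸ m) g g≡0 ⟩
  sumBelow m g               ≡⟨ sumBelow-extend m (n′ ∸ m) g g≡0 ⟨
  sumBelow (m + (n′ ∸ m)) g  ≡⟨ cong (λ z → sumBelow z g) (m+[n∸m]≡n m≤n′) ⟩
  sumBelow n′ g            ∎
  where open ≡-Reasoning

sumBelow-⊕₃ : ∀ N (f g h : ℕ → Parity) →
  sumBelow N (λ i → f i ⊕ g i ⊕ h i) ≡ sumBelow N f ⊕ sumBelow N g ⊕ sumBelow N h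
sumBelow-⊕₃ N f g h = trans (∑-distrib-+ {N} (λ i → f (toℕ i) ⊕ g (toℕ i)) (h ∘ toℕ))
  (cong (_⊕ sumBelow N h) (∑-distrib-+ {N} (f ∘ toℕ) (g ∘ toℕ)))

sumBelow-zeroˡ : ∀ N (f g : ℕ → Parity) → (∀ l → f l ≡ 0ℙ) → sumBelow N (λ l → f l · g l) ≡ 0ℙ
sumBelow-zeroˡ N f g f≡0 = sumBelow-zero N _ λ l _ → cong (_· g l) (f≡0 l)

sumBelow-zeroʳ : ∀ N (f g : ℕ → Parity) → (∀ l → g l ≡ 0ℙ) → sumBelow N (λ l → f l · g l) ≡ 0ℙ
sumBelow-zeroʳ N f g g≡0 = sumBelow-zero N _ λ l _ → trans (cong (f l ·_) (g≡0 l)) (Parityₚ.*-zeroʳ (f l))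

δ : ℕ → ℕ → Parity
δ zero    zero    = 1ℙ
δ zero    (suc _) = 0ℙ
δ (suc _) zero    = 0ℙ
δ (suc m) (suc n) = δ m n

δ-refl : ∀ m → δ m m ≡ 1ℙ
δ-refl zero = refl
δ-refl (suc m) = δ-refl m

δ-≢ : ∀ m n → m ≢ n → δ m n ≡ 0ℙ
δ-≢ zero zero m≢n = ⊥-elim (m≢n refl)
δ-≢ zero (suc n) _ = refl
δ-≢ (suc m) zero _ = refl
δ-≢ (suc m) (suc n) m≢n = δ-≢ m n (m≢n ∘ cong suc)

δ-< : ∀ m k → k < m → δ m k ≡ 0ℙ
δ-< m k k<m = δ-≢ m k λ m≡k → <-irrefl (sym m≡k) k<m

δ-sym : ∀ m n → δ m n ≡ δ n m
δ-sym zero zero = refl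
δ-sym zero (suc n) = refl
δ-sym (suc m) zero = refl
δ-sym (suc m) (suc n) = δ-sym m n

δ-⇔ : ∀ a b c d → (a ≡ b → c ≡ d) → (c ≡ d → a ≡ b) → δ a b ≡ δ c d
δ-⇔ a b c d to from with a ℕₚ.≟ b
... | yes refl = trans (δ-refl a) (sym (subst (λ x → δ c x ≡ 1ℙ) (to refl) (δ-refl c)))
... | no a≢b = trans (δ-≢ a b a≢b) (sym (δ-≢ c d (a≢b ∘ from)))

δ-shift : ∀ i a b → δ (i + a) (i + b) ≡ δ a b
δ-shift zero a b = refl
δ-shift (suc i) a b = δ-shift i a b

δ-shiftˡ : ∀ i b → δ i (i + b) ≡ δ 0 b
δ-shiftˡ i b = trans (cong (λ x → δ x (i + b)) (sym (ℕₚ.+-identityʳ i))) (δ-shift i 0 b)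

·-δ-sym : ∀ (w : ℕ → Parity) l k → w l · δ l k ≡ w k · δ k l
·-δ-sym w zero zero = refl
·-δ-sym w zero (suc k) = trans (Parityₚ.*-zeroʳ (w zero)) (sym (Parityₚ.*-zeroʳ (w (suc k))))
·-δ-sym w (suc l) zero = trans (Parityₚ.*-zeroʳ (w (suc l))) (sym (Parityₚ.*-zeroʳ (w zero)))
·-δ-sym w (suc l) (suc k) = ·-δ-sym (w ∘ suc) l k

sumBelow-δ : ∀ N (u : ℕ → Parity) k → k < N → sumBelow N (λ l → u l · δ l k) ≡ u k
sumBelow-δ (suc N) u zero _ = trans (cong₂ _⊕_ (Parityₚ.*-identityʳ (u 0)) (sumBelow-zero N _ λ i _ → Parityₚ.*-zeroʳ (u (suc i))))
                                    (Parityₚ.+-identityʳ (u 0))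
sumBelow-δ (suc N) u (suc k) (s≤s k<N) =
  trans (cong (_⊕ sumBelow N (λ l → u (suc l) · δ l k)) (Parityₚ.*-zeroʳ (u 0))) (sumBelow-δ N (u ∘ suc) k k<N)

parity-sumℕ : ∀ n (g : ℕ → ℕ) → parity (sumℕ n g) ≡ sumBelow n (parity ∘ g)
parity-sumℕ zero g = refl
parity-sumℕ (suc n) g = begin
  parity (sumℕ n g + g n)              ≡⟨ Parityₚ.+-homo-+ (sumℕ n g) (g n) ⟩
  parity (sumℕ n g) ⊕ parity (g n)     ≡⟨ cong (_⊕ parity (g n)) (parity-sumℕ n g) ⟩
  sumBelow n (parity ∘ g) ⊕ parity (g n) ≡⟨ sumBelow-suc n (parity ∘ g) ⟨
  sumBelow (suc n) (parity ∘ g)        ∎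
  where open ≡-Reasoning

parity-indicator : ∀ a b → parity (if ⌊ a ℕₚ.≟ b ⌋ then 1 else 0) ≡ δ a b
parity-indicator a b with a ℕₚ.≟ b
... | yes refl = sym (δ-refl a)
... | no a≢b = sym (δ-≢ a b a≢b)

double : ℕ → ℕ
double zero    = zero
double (suc n) = suc (suc (double n))

data Halves : ℕ → Set where
  even : ∀ j → Halves (double j)
  odd  : ∀ j → Halves (suc (double j))

halves : ∀ n → Halves n
halves zero = even 0
halves (suc zero) = odd 0
halves (suc (suc n)) with halves n
... | even j = even (suc j)
... | odd j = odd (suc j)

double≡2* : ∀ n → double n ≡ 2 * n
double≡2* zero = refl
double≡2* (suc n) = trans (cong (λ (x : ℕ) → suc (suc x)) (double≡2* n)) (lemma n)
  where
  lemma : ∀ n → 2 + 2 * n ≡ 2 * suc n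
  lemma = solve-∀

double≡+ : ∀ j → double j ≡ j + j
double≡+ zero = refl
double≡+ (suc j) = cong suc (trans (cong suc (double≡+ j)) (sym (+-suc j j)))

double-+ : ∀ m n → double m + double n ≡ double (m + n)
double-+ zero n = refl
double-+ (suc m) n = cong (λ (x : ℕ) → suc (suc x)) (double-+ m n)

double-injective : ∀ {m n} → double m ≡ double n → m ≡ n
double-injective {zero} {zero} _ = refl
double-injective {suc m} {suc n} e = cong suc (double-injective (ℕₚ.suc-injective (ℕₚ.suc-injective e)))

double≢suc-double : ∀ m n → double m ≢ suc (double n)
double≢suc-double (suc m) (suc n) e = double≢suc-double m n (ℕₚ.suc-injective (ℕₚ.suc-injective e))

n≤double : ∀ n → n ≤ double n
n≤double zero = z≤n
n≤double (suc n) = s≤s (≤-trans (n≤double n) (n≤1+n _))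

suc≤double : ∀ x → 1 ≤ x → suc x ≤ double x
suc≤double (suc x) _ = s≤s (s≤s (n≤double x))

double-cancel-< : ∀ m n → double m < double n → m < n
double-cancel-< zero (suc n) _ = s≤s z≤n
double-cancel-< (suc m) (suc n) (s≤s (s≤s d<d)) = s≤s (double-cancel-< m n d<d)

δ-double : ∀ a b → δ (double a) (double b) ≡ δ a b
δ-double zero zero = refl
δ-double zero (suc b) = refl
δ-double (suc a) zero = refl
δ-double (suc a) (suc b) = δ-double a b

parity-double : ∀ j → parity (double j) ≡ 0ℙ
parity-double zero = refl
parity-double (suc j) = parity-double j

half-double : ∀ j → ⌊ double j /2⌋ ≡ j
half-double zero = refl
half-double (suc j) = cong suc (half-double j)

half-suc-double : ∀ j → ⌊ suc (double j) /2⌋ ≡ j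
half-suc-double zero = refl
half-suc-double (suc j) = cong suc (half-suc-double j)

sumBelow-double : ∀ m (g : ℕ → Parity) →
  sumBelow (double m) g ≡ sumBelow m (λ l → g (double l)) ⊕ sumBelow m (λ l → g (suc (double l)))
sumBelow-double zero g = refl
sumBelow-double (suc m) g = begin
  g 0 ⊕ (g 1 ⊕ sumBelow (double m) (λ i → g (suc (suc i))))
    ≡⟨ cong (λ z → g 0 ⊕ (g 1 ⊕ z)) (sumBelow-double m (λ i → g (suc (suc i)))) ⟩
  g 0 ⊕ (g 1 ⊕ (X ⊕ Y))
    ≡⟨ interchange (g 0) (g 1) X Y ⟩
  g 0 ⊕ X ⊕ (g 1 ⊕ Y) ∎
  where
  open ≡-Reasoning
  X = sumBelow m (λ l → g (suc (suc (double l))))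
  Y = sumBelow m (λ l → g (suc (suc (suc (double l)))))
  interchange : ∀ a b x y → a ⊕ (b ⊕ (x ⊕ y)) ≡ a ⊕ x ⊕ (b ⊕ y)
  interchange a b x y = begin
    a ⊕ (b ⊕ (x ⊕ y))   ≡⟨ cong (a ⊕_) (Parityₚ.+-assoc b x y) ⟨
    a ⊕ (b ⊕ x ⊕ y)     ≡⟨ cong (λ z → a ⊕ (z ⊕ y)) (Parityₚ.+-comm b x) ⟩
    a ⊕ (x ⊕ b ⊕ y)     ≡⟨ cong (a ⊕_) (Parityₚ.+-assoc x b y) ⟩
    a ⊕ (x ⊕ (b ⊕ y))   ≡⟨ Parityₚ.+-assoc a x (b ⊕ y) ⟨
    a ⊕ x ⊕ (b ⊕ y)     ∎

-- Parity of the coefficients of f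

-- coeff n counts the pairs (k , j) with rep k j ≡ n + 4; rep k j is the exponent
-- 2^(k+2) + j·2^(k+1) of x^4 · f, with k shifted down by one.
rep : ℕ → ℕ → ℕ
rep k j = 2 ^ (suc k + 1) + j * 2 ^ suc k

repsIn : ℕ → ℕ → ℕ → Parity
repsIn K J N = sumBelow K λ k → sumBelow J λ j → δ (rep k j) N

reps : ℕ → Parity
reps N = repsIn N N N

parity-coeff : ∀ n → parity (coeff n) ≡ reps (n + 4)
parity-coeff n = trans (parity-sumℕ (n + 4) (λ k → sumℕ (n + 4) (indicator k))) (sumBelow-cong (n + 4) λ k _ →
  trans (parity-sumℕ (n + 4) (indicator k)) (sumBelow-cong (n + 4) λ j _ → parity-indicator (rep k j) (n + 4)))
  where
  indicator : ℕ → ℕ → ℕ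
  indicator k j = if ⌊ rep k j ℕₚ.≟ n + 4 ⌋ then 1 else 0

rep-zero : ∀ j → rep 0 j ≡ double (2 + j)
rep-zero j = trans (lemma j) (sym (double≡2* (2 + j)))
  where
  lemma : ∀ j → 4 + j * 2 ≡ 2 * (2 + j)
  lemma = solve-∀

rep-suc : ∀ k j → rep (suc k) j ≡ double (rep k j)
rep-suc k j = trans (lemma (2 ^ (suc k + 1)) (2 ^ suc k) j) (sym (double≡2* (rep k j)))
  where
  lemma : ∀ a b j → 2 * a + j * (2 * b) ≡ 2 * (a + j * b)
  lemma = solve-∀

rep≢odd : ∀ k j M → rep k j ≢ suc (double M)
rep≢odd zero j M e = double≢suc-double (2 + j) M (trans (sym (rep-zero j)) e)
rep≢odd (suc k) j M e = double≢suc-double (rep k j) M (trans (sym (rep-suc k j)) e)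

rep-bounds : ∀ k j → k < rep k j × j < rep k j
rep-bounds zero j = subst (λ r → 0 < r × j < r) (sym (rep-zero j))
  (s≤s z≤n , s≤s (≤-trans (n≤double j) (m≤n+m (double j) 3)))
rep-bounds (suc k) j with rep-bounds k j
... | k<r , j<r = subst (λ r → suc k < r × j < r) (sym (rep-suc k j))
  ( ≤-trans (s≤s k<r) (suc≤double (rep k j) (≤-trans (s≤s z≤n) k<r))
  , ≤-trans j<r (≤-trans (n≤1+n _) (suc≤double (rep k j) (≤-trans (s≤s z≤n) k<r))))

δ-rep-≥ : ∀ N k j → N ≤ k ⊎ N ≤ j → δ (rep k j) N ≡ 0ℙ
δ-rep-≥ N k j N≤ = δ-≢ (rep k j) N λ r≡N → <-irrefl refl (bound r≡N N≤)
  where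
  bound : rep k j ≡ N → N ≤ k ⊎ N ≤ j → N < N
  bound refl (inj₁ r≤k) = ≤-trans (s≤s r≤k) (proj₁ (rep-bounds k j))
  bound refl (inj₂ r≤j) = ≤-trans (s≤s r≤j) (proj₂ (rep-bounds k j))

repsIn-range : ∀ K J N → N ≤ K → N ≤ J → repsIn K J N ≡ reps N
repsIn-range K J N N≤K N≤J = begin
  sumBelow K (λ k → sumBelow J λ j → δ (rep k j) N)
    ≡⟨ sumBelow-cong K (λ k _ → sumBelow-support N J N _ N≤J ≤-refl λ j N≤j → δ-rep-≥ N k j (inj₂ N≤j)) ⟩
  sumBelow K (λ k → sumBelow N λ j → δ (rep k j) N)
    ≡⟨ sumBelow-support N K N _ N≤K ≤-refl (λ k N≤k → sumBelow-zero N _ λ j _ → δ-rep-≥ N k j (inj₁ N≤k)) ⟩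
  reps N ∎
  where open ≡-Reasoning

reps-odd : ∀ M → reps (suc (double M)) ≡ 0ℙ
reps-odd M = sumBelow-zero N _ λ k _ → sumBelow-zero N (λ j → δ (rep k j) N) λ j _ →
  δ-≢ (rep k j) N (rep≢odd k j M)
  where N = suc (double M)

atLeast2 : ℕ → Parity
atLeast2 zero = 0ℙ
atLeast2 (suc zero) = 0ℙ
atLeast2 (suc (suc _)) = 1ℙ

sumBelow-δ₂ : ∀ M → sumBelow (double M) (λ j → δ (2 + j) M) ≡ atLeast2 M
sumBelow-δ₂ zero = refl
sumBelow-δ₂ (suc zero) = sumBelow-zero 2 _ λ _ _ → refl
sumBelow-δ₂ (suc (suc M)) = sumBelow-δ (double (suc (suc M))) (λ _ → 1ℙ) M (s≤s (≤-trans (n≤double M) (m≤n+m _ 3)))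

-- The pairs with k = 0 contribute the single solution j = M - 2; the others are the
-- representations of M, doubled.
reps-double : ∀ M → reps (double M) ≡ atLeast2 M ⊕ reps M
reps-double zero = refl
reps-double (suc M) = cong₂ _⊕_ kZero kSuc
  where
  N = double (suc M)
  kZero : sumBelow N (λ j → δ (rep 0 j) N) ≡ atLeast2 (suc M)
  kZero = trans (sumBelow-cong N λ j _ → trans (cong (λ r → δ r N) (rep-zero j))
                                               (δ-⇔ _ _ (2 + j) (suc M) double-injective (cong double)))
                (sumBelow-δ₂ (suc M))
  kSuc : sumBelow (suc (double M)) (λ k → sumBelow N λ j → δ (rep (suc k) j) N) ≡ reps (suc M)
  kSuc = trans (sumBelow-cong (suc (double M)) λ k _ → sumBelow-cong N λ j _ →
                 trans (cong (λ r → δ r N) (rep-suc k j)) (δ-⇔ _ _ (rep k j) (suc M) double-injective (cong double)))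
               (repsIn-range (suc (double M)) N (suc M) (s≤s (n≤double M)) (n≤double (suc M)))

coeff₂ : ℕ → Parity
coeff₂ n = parity (coeff n)

coeff₂-odd : ∀ t → coeff₂ (suc (double t)) ≡ 0ℙ
coeff₂-odd t = begin
  coeff₂ (suc (double t))        ≡⟨ parity-coeff (suc (double t)) ⟩
  reps (suc (double t) + 4)      ≡⟨ cong (λ n → reps (suc n)) (double-+ t 2) ⟩
  reps (suc (double (t + 2)))    ≡⟨ reps-odd (t + 2) ⟩
  0ℙ                             ∎
  where open ≡-Reasoning

coeff₂-even : ∀ t → coeff₂ (double t) ≡ reps (2 + t) ⁻¹
coeff₂-even t = begin
  coeff₂ (double t)              ≡⟨ parity-coeff (double t) ⟩
  reps (double t + 4)            ≡⟨ cong reps (trans (double-+ t 2) (cong double (+-comm t 2))) ⟩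
  reps (double (2 + t))          ≡⟨ reps-double (2 + t) ⟩
  reps (2 + t) ⁻¹                ∎
  where open ≡-Reasoning

coeff₂-even-rec : ∀ t → coeff₂ (double (suc (suc t))) ≡ coeff₂ t ⁻¹
coeff₂-even-rec t = begin
  coeff₂ (double (2 + t))        ≡⟨ coeff₂-even (2 + t) ⟩
  reps (4 + t) ⁻¹                ≡⟨ cong (λ n → reps n ⁻¹) (+-comm 4 t) ⟩
  reps (t + 4) ⁻¹                ≡⟨ cong _⁻¹ (parity-coeff t) ⟨
  coeff₂ t ⁻¹                    ∎
  where open ≡-Reasoning

-- The Jacobi operator over 𝔽₂

evenℙ : ℕ → Parity
evenℙ zero    = 1ℙ
evenℙ (suc n) = evenℙ n ⁻¹

prev : (ℕ → Parity) → ℕ → Parity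
prev v zero    = 0ℙ
prev v (suc i) = v i

jacobi : (ℕ → Parity) → ℕ → Parity
jacobi v i = prev v i ⊕ evenℙ i · v i ⊕ v (suc i)

jacobiPow : ℕ → ℕ → Parity
jacobiPow zero    i = δ i 0
jacobiPow (suc t) i = jacobi (jacobiPow t) i

dot : ℕ → (ℕ → Parity) → (ℕ → Parity) → Parity
dot N u v = sumBelow N (λ i → u i · v i)

sumBelow-shift : ∀ N (u v : ℕ → Parity) → u (suc N) ≡ 0ℙ →
  sumBelow (suc N) (λ i → u (suc i) · v i) ≡ sumBelow (suc N) (λ i → u i · prev v i)
sumBelow-shift N u v u≡0 = begin
  sumBelow (suc N) (λ i → u (suc i) · v i)    ≡⟨ sumBelow-suc-zero N (λ i → u (suc i) · v i) (cong (_· v N) u≡0) ⟩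
  sumBelow N (λ i → u (suc i) · v i)          ≡⟨⟩
  0ℙ ⊕ sumBelow N (λ i → u (suc i) · v i)     ≡⟨ cong (_⊕ sumBelow N (λ i → u (suc i) · v i)) (Parityₚ.*-zeroʳ (u 0)) ⟨
  sumBelow (suc N) (λ i → u i · prev v i)     ∎
  where open ≡-Reasoning

jacobiPow-vanish : ∀ t i → t < i → jacobiPow t i ≡ 0ℙ
jacobiPow-vanish zero (suc i) _ = refl
jacobiPow-vanish (suc t) (suc i) (s≤s t<i) = cong₂ _⊕_
  (cong₂ _⊕_ (jacobiPow-vanish t i t<i) (trans (cong (evenℙ (suc i) ·_) (jacobiPow-vanish t (suc i) (≤-trans t<i (n≤1+n _))))
                                          (Parityₚ.*-zeroʳ _)))
  (jacobiPow-vanish t (suc (suc i)) (≤-trans t<i (≤-trans (n≤1+n _) (n≤1+n _))))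

jacobiPow-diag : ∀ t → jacobiPow t t ≡ 1ℙ
jacobiPow-diag zero = refl
jacobiPow-diag (suc t) = cong₂ _⊕_
  (cong₂ _⊕_ (jacobiPow-diag t) (trans (cong (evenℙ (suc t) ·_) (jacobiPow-vanish t (suc t) ≤-refl)) (Parityₚ.*-zeroʳ _)))
  (jacobiPow-vanish t (suc (suc t)) (n≤1+n _))

jacobi-selfAdjoint : ∀ N (u v : ℕ → Parity) → u (suc N) ≡ 0ℙ → v (suc N) ≡ 0ℙ →
  dot (suc N) (jacobi u) v ≡ dot (suc N) u (jacobi v)
jacobi-selfAdjoint N u v u≡0 v≡0 = begin
  sumBelow (suc N) (λ i → jacobi u i · v i)
    ≡⟨ sumBelow-cong (suc N) (λ i _ → ·-distribʳ-⊕₃ (prev u i) (evenℙ i · u i) (u (suc i)) (v i)) ⟩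
  sumBelow (suc N) (λ i → prev u i · v i ⊕ evenℙ i · u i · v i ⊕ u (suc i) · v i)
    ≡⟨ sumBelow-⊕₃ (suc N) (λ i → prev u i · v i) (λ i → evenℙ i · u i · v i) (λ i → u (suc i) · v i) ⟩
  S (λ i → prev u i · v i) ⊕ S (λ i → evenℙ i · u i · v i) ⊕ S (λ i → u (suc i) · v i)
    ≡⟨ cong₂ _⊕_ (cong₂ _⊕_ outer middle) (sumBelow-shift N u v u≡0) ⟩
  S (λ i → u i · v (suc i)) ⊕ S (λ i → u i · (evenℙ i · v i)) ⊕ S (λ i → u i · prev v i)
    ≡⟨ ⊕-reverse₃ (S (λ i → u i · v (suc i))) (S (λ i → u i · (evenℙ i · v i))) (S (λ i → u i · prev v i)) ⟩
  S (λ i → u i · prev v i) ⊕ S (λ i → u i · (evenℙ i · v i)) ⊕ S (λ i → u i · v (suc i))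
    ≡⟨ sumBelow-⊕₃ (suc N) (λ i → u i · prev v i) (λ i → u i · (evenℙ i · v i)) (λ i → u i · v (suc i)) ⟨
  sumBelow (suc N) (λ i → u i · prev v i ⊕ u i · (evenℙ i · v i) ⊕ u i · v (suc i))
    ≡⟨ sumBelow-cong (suc N) (λ i _ → ·-distribˡ-⊕₃ (u i) (prev v i) (evenℙ i · v i) (v (suc i))) ⟨
  sumBelow (suc N) (λ i → u i · jacobi v i) ∎
  where
  open ≡-Reasoning
  S = sumBelow (suc N)
  outer : S (λ i → prev u i · v i) ≡ S (λ i → u i · v (suc i))
  outer = begin
    S (λ i → prev u i · v i)     ≡⟨ sumBelow-cong (suc N) (λ i _ → Parityₚ.*-comm (prev u i) (v i)) ⟩
    S (λ i → v i · prev u i)     ≡⟨ sumBelow-shift N v u v≡0 ⟨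
    S (λ i → v (suc i) · u i)    ≡⟨ sumBelow-cong (suc N) (λ i _ → Parityₚ.*-comm (v (suc i)) (u i)) ⟩
    S (λ i → u i · v (suc i))    ∎
  middle : S (λ i → evenℙ i · u i · v i) ≡ S (λ i → u i · (evenℙ i · v i))
  middle = sumBelow-cong (suc N) λ i _ → trans (cong (_· v i) (Parityₚ.*-comm (evenℙ i) (u i))) (Parityₚ.*-assoc (u i) (evenℙ i) (v i))

-- jacobiPow t is J^t e₀, and self-adjointness moves all powers of J to one side.
dot-jacobiPow : ∀ j k N → j + k < N → dot N (jacobiPow j) (jacobiPow k) ≡ jacobiPow (j + k) 0
dot-jacobiPow zero k (suc N) _ =
  trans (cong (jacobiPow k 0 ⊕_) (sumBelow-zero N _ λ _ _ → refl)) (Parityₚ.+-identityʳ _)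
dot-jacobiPow (suc j) k (suc N) (s≤s j+k<N) = begin
  dot (suc N) (jacobi (jacobiPow j)) (jacobiPow k)
    ≡⟨ jacobi-selfAdjoint N (jacobiPow j) (jacobiPow k)
         (jacobiPow-vanish j (suc N) (≤-trans (s≤s (m≤m+n j k)) (≤-trans j+k<N (n≤1+n N))))
         (jacobiPow-vanish k (suc N) (≤-trans (s≤s (m≤n+m k j)) (≤-trans j+k<N (n≤1+n N)))) ⟩
  dot (suc N) (jacobiPow j) (jacobiPow (suc k))
    ≡⟨ dot-jacobiPow j (suc k) (suc N) (s≤s (subst (_≤ N) (sym (+-suc j k)) j+k<N)) ⟩
  jacobiPow (j + suc k) 0
    ≡⟨ cong (λ t → jacobiPow t 0) (+-suc j k) ⟩
  jacobiPow (suc j + k) 0 ∎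
  where open ≡-Reasoning

dot-jacobiPow-range : ∀ j (v : ℕ → Parity) N N′ → suc j ≤ N → suc j ≤ N′ →
  sumBelow N (λ l → jacobiPow j l · v l) ≡ sumBelow N′ (λ l → jacobiPow j l · v l)
dot-jacobiPow-range j v N N′ j<N j<N′ =
  sumBelow-support (suc j) N N′ (λ l → jacobiPow j l · v l) j<N j<N′ λ i j<i → cong (_· v i) (jacobiPow-vanish j i j<i)

evenSum : ℕ → (ℕ → Parity) → Parity
evenSum N u = sumBelow N (λ i → evenℙ i · u i)

-- Both off-diagonal parts of J contribute Σ_{i<N} [i odd] uᵢ and cancel.
evenSum-jacobi : ∀ N (u : ℕ → Parity) → u N ≡ 0ℙ → u (suc N) ≡ 0ℙ → evenSum (suc N) (jacobi u) ≡ evenSum (suc N) u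
evenSum-jacobi N u u≡0 u′≡0 = begin
  sumBelow (suc N) (λ i → evenℙ i · jacobi u i)
    ≡⟨ sumBelow-cong (suc N) (λ i _ → ·-distribˡ-⊕₃ (evenℙ i) (prev u i) (evenℙ i · u i) (u (suc i))) ⟩
  sumBelow (suc N) (λ i → evenℙ i · prev u i ⊕ evenℙ i · (evenℙ i · u i) ⊕ evenℙ i · u (suc i))
    ≡⟨ sumBelow-⊕₃ (suc N) (λ i → evenℙ i · prev u i) (λ i → evenℙ i · (evenℙ i · u i)) (λ i → evenℙ i · u (suc i)) ⟩
  O ⊕ sumBelow (suc N) (λ i → evenℙ i · (evenℙ i · u i)) ⊕ sumBelow (suc N) (λ i → evenℙ i · u (suc i))
    ≡⟨ cong₂ (λ x y → O ⊕ x ⊕ y) (sumBelow-cong (suc N) λ i _ → ·-idem-assoc (evenℙ i) (u i)) shifted ⟩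
  O ⊕ evenSum (suc N) u ⊕ O
    ≡⟨ ⊕-sandwich O (evenSum (suc N) u) ⟩
  evenSum (suc N) u ∎
  where
  open ≡-Reasoning
  oddPart : ℕ → Parity
  oddPart i = evenℙ i ⁻¹ · u i
  O = sumBelow N oddPart
  shifted : sumBelow (suc N) (λ i → evenℙ i · u (suc i)) ≡ O
  shifted = begin
    sumBelow (suc N) (λ i → evenℙ i · u (suc i))
      ≡⟨ sumBelow-cong (suc N) (λ i _ → cong (_· u (suc i)) (sym (Parityₚ.⁻¹-involutive (evenℙ i)))) ⟩
    sumBelow (suc N) (λ i → oddPart (suc i))
      ≡⟨⟩
    sumBelow (suc (suc N)) oddPart
      ≡⟨ sumBelow-suc-zero (suc N) oddPart (trans (cong (evenℙ (suc N) ⁻¹ ·_) u′≡0) (Parityₚ.*-zeroʳ _)) ⟩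
    sumBelow (suc N) oddPart
      ≡⟨ sumBelow-suc-zero N oddPart (trans (cong (evenℙ N ⁻¹ ·_) u≡0) (Parityₚ.*-zeroʳ _)) ⟩
    O ∎

evenSum-jacobiPow : ∀ j N → j < N → evenSum N (jacobiPow j) ≡ 1ℙ
evenSum-jacobiPow zero (suc N) _ =
  cong _⁻¹ (sumBelow-zero N (λ i → evenℙ (suc i) · δ (suc i) 0) λ i _ → Parityₚ.*-zeroʳ (evenℙ (suc i)))
evenSum-jacobiPow (suc j) (suc N) (s≤s j<N) = trans
  (evenSum-jacobi N (jacobiPow j) (jacobiPow-vanish j N j<N) (jacobiPow-vanish j (suc N) (≤-trans j<N (n≤1+n N))))
  (evenSum-jacobiPow j (suc N) (≤-trans j<N (n≤1+n N)))

dot-jacobi-self : ∀ N (u : ℕ → Parity) → u (suc N) ≡ 0ℙ → dot (suc N) (jacobi u) u ≡ evenSum (suc N) u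
dot-jacobi-self N u u≡0 = begin
  sumBelow (suc N) (λ i → jacobi u i · u i)
    ≡⟨ sumBelow-cong (suc N) (λ i _ → ·-distribʳ-⊕₃ (prev u i) (evenℙ i · u i) (u (suc i)) (u i)) ⟩
  sumBelow (suc N) (λ i → prev u i · u i ⊕ evenℙ i · u i · u i ⊕ u (suc i) · u i)
    ≡⟨ sumBelow-⊕₃ (suc N) (λ i → prev u i · u i) (λ i → evenℙ i · u i · u i) (λ i → u (suc i) · u i) ⟩
  P ⊕ S (λ i → evenℙ i · u i · u i) ⊕ S (λ i → u (suc i) · u i)
    ≡⟨ cong₂ (λ x y → P ⊕ x ⊕ y) (sumBelow-cong (suc N) λ i _ → square (evenℙ i) (u i)) shifted ⟩
  P ⊕ evenSum (suc N) u ⊕ P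
    ≡⟨ ⊕-sandwich P (evenSum (suc N) u) ⟩
  evenSum (suc N) u ∎
  where
  open ≡-Reasoning
  S = sumBelow (suc N)
  P = S (λ i → prev u i · u i)
  square : ∀ a x → a · x · x ≡ a · x
  square a x = trans (Parityₚ.*-assoc a x x) (cong (a ·_) (Parityₚ.*-idem x))
  shifted : S (λ i → u (suc i) · u i) ≡ P
  shifted = trans (sumBelow-shift N u u u≡0) (sumBelow-cong (suc N) λ i _ → Parityₚ.*-comm (u i) (prev u i))

sum-jacobi : ∀ N (u : ℕ → Parity) → u N ≡ 0ℙ → u (suc N) ≡ 0ℙ → evenSum (suc N) u ≡ 1ℙ →
  sumBelow (suc N) (jacobi u) ≡ u 0 ⁻¹
sum-jacobi N u u≡0 u′≡0 evenSum≡1 = begin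
  sumBelow (suc N) (jacobi u)
    ≡⟨ sumBelow-⊕₃ (suc N) (prev u) (λ i → evenℙ i · u i) (λ i → u (suc i)) ⟩
  sumBelow N u ⊕ evenSum (suc N) u ⊕ B
    ≡⟨ cong₂ (λ x y → x ⊕ y ⊕ B) (sym total) evenSum≡1 ⟩
  u 0 ⊕ B ⊕ 1ℙ ⊕ B
    ≡⟨ cancel (u 0) B ⟩
  u 0 ⁻¹ ∎
  where
  open ≡-Reasoning
  B = sumBelow (suc N) (λ i → u (suc i))
  total : u 0 ⊕ B ≡ sumBelow N u
  total = trans (sumBelow-suc-zero (suc N) u u′≡0) (sumBelow-suc-zero N u u≡0)
  cancel : ∀ x b → x ⊕ b ⊕ 1ℙ ⊕ b ≡ x ⁻¹
  cancel 0ℙ 0ℙ = refl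
  cancel 0ℙ 1ℙ = refl
  cancel 1ℙ 0ℙ = refl
  cancel 1ℙ 1ℙ = refl

jacobiPow-odd : ∀ j → jacobiPow (suc (double j)) 0 ≡ 1ℙ
jacobiPow-odd j = begin
  jacobiPow (suc (double j)) 0                  ≡⟨ cong (λ t → jacobiPow (suc t) 0) (double≡+ j) ⟩
  jacobiPow (suc j + j) 0                       ≡⟨ dot-jacobiPow (suc j) j N ≤-refl ⟨
  dot N (jacobi (jacobiPow j)) (jacobiPow j)    ≡⟨ dot-jacobi-self (suc (j + j)) (jacobiPow j) (jacobiPow-vanish j N j<N) ⟩
  evenSum N (jacobiPow j)                       ≡⟨ evenSum-jacobiPow j N j<N ⟩
  1ℙ                                            ∎
  where
  open ≡-Reasoning
  N = suc (suc (j + j))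
  j<N : j < N
  j<N = s≤s (≤-trans (m≤m+n j j) (n≤1+n _))

jacobiPow-even : ∀ j → jacobiPow (double (suc j)) 0 ≡ jacobiPow j 0 ⁻¹
jacobiPow-even j = begin
  jacobiPow (double (suc j)) 0                        ≡⟨ cong (λ t → jacobiPow t 0) (double≡+ (suc j)) ⟩
  jacobiPow (suc j + suc j) 0                         ≡⟨ dot-jacobiPow (suc j) (suc j) (suc M) ≤-refl ⟨
  dot (suc M) (jacobiPow (suc j)) (jacobiPow (suc j)) ≡⟨ sumBelow-cong (suc M) (λ i _ → Parityₚ.*-idem (jacobiPow (suc j) i)) ⟩
  sumBelow (suc M) (jacobi (jacobiPow j))             ≡⟨ sum-jacobi M (jacobiPow j) (jacobiPow-vanish j M j<M)
                                                           (jacobiPow-vanish j (suc M) (≤-trans j<M (n≤1+n _)))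
                                                           (evenSum-jacobiPow j (suc M) (≤-trans j<M (n≤1+n _))) ⟩
  jacobiPow j 0 ⁻¹                                    ∎
  where
  open ≡-Reasoning
  M = suc j + suc j
  j<M : j < M
  j<M = m≤m+n (suc j) (suc j)

coeff₂-even≡jacobiPow : ∀ t → coeff₂ (double t) ≡ jacobiPow t 0
coeff₂-even≡jacobiPow = <-rec (λ t → coeff₂ (double t) ≡ jacobiPow t 0) step
  where
  step : ∀ t → (∀ {s} → s < t → coeff₂ (double s) ≡ jacobiPow s 0) → coeff₂ (double t) ≡ jacobiPow t 0
  step zero _ = trans (coeff₂-even 0) (cong _⁻¹ (trans (reps-double 1) (reps-odd 0)))
  step (suc zero) _ = trans (coeff₂-even 1) (cong _⁻¹ (reps-odd 1))
  step (suc (suc t)) ih with halves t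
  ... | even j = begin
    coeff₂ (double (2 + double j))   ≡⟨ coeff₂-even-rec (double j) ⟩
    coeff₂ (double j) ⁻¹             ≡⟨ cong _⁻¹ (ih (s≤s (≤-trans (n≤double j) (n≤1+n _)))) ⟩
    jacobiPow j 0 ⁻¹                 ≡⟨ jacobiPow-even j ⟨
    jacobiPow (double (suc j)) 0     ∎
    where open ≡-Reasoning
  ... | odd j = begin
    coeff₂ (double (3 + double j))   ≡⟨ coeff₂-even-rec (suc (double j)) ⟩
    coeff₂ (suc (double j)) ⁻¹       ≡⟨ cong _⁻¹ (coeff₂-odd j) ⟩
    1ℙ                               ≡⟨ jacobiPow-odd (suc j) ⟨
    jacobiPow (suc (double (suc j))) 0 ∎
    where open ≡-Reasoning

selectBlock : Parity → Parity → Parity → Parity → Parity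
selectBlock 0ℙ 0ℙ e o = e
selectBlock 0ℙ 1ℙ e o = 0ℙ
selectBlock 1ℙ 0ℙ e o = 0ℙ
selectBlock 1ℙ 1ℙ e o = o

blocks : (ℕ → ℕ → Parity) → (ℕ → ℕ → Parity) → ℕ → ℕ → Parity
blocks E O r s = selectBlock (parity r) (parity s) (E ⌊ r /2⌋ ⌊ s /2⌋) (O ⌊ r /2⌋ ⌊ s /2⌋)

module _ (E O : ℕ → ℕ → Parity) where

  blocks-ee : ∀ j l → blocks E O (double j) (double l) ≡ E j l
  blocks-ee j l rewrite parity-double j | parity-double l | half-double j | half-double l = refl

  blocks-eo : ∀ j l → blocks E O (double j) (suc (double l)) ≡ 0ℙ
  blocks-eo j l rewrite parity-double j | parity-suc (double l) | parity-double l = refl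

  blocks-oe : ∀ j l → blocks E O (suc (double j)) (double l) ≡ 0ℙ
  blocks-oe j l rewrite parity-suc (double j) | parity-double j | parity-double l = refl

  blocks-oo : ∀ j l → blocks E O (suc (double j)) (suc (double l)) ≡ O j l
  blocks-oo j l rewrite parity-suc (double j) | parity-double j | parity-suc (double l) | parity-double l
                      | half-suc-double j | half-suc-double l = refl

U : ℕ → ℕ → Parity
U = blocks jacobiPow jacobiPow

Kₑ Kₒ : ℕ → ℕ → Parity
Kₑ l k = jacobiPow k l
Kₒ l k = jacobiPow (suc k) l

K : ℕ → ℕ → Parity
K = blocks Kₑ Kₒ

jacobiEntry : ℕ → ℕ → Parity
jacobiEntry l k = jacobi (λ x → δ x k) l

D : ℕ → ℕ → Parity
D = blocks δ jacobiEntry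

U-vanish : ∀ r p → r < p → U r p ≡ 0ℙ
U-vanish r p r<p with halves r | halves p
... | even j | even l = trans (blocks-ee jacobiPow jacobiPow j l) (jacobiPow-vanish j l (double-cancel-< j l r<p))
... | even j | odd l = blocks-eo jacobiPow jacobiPow j l
... | odd j | even l = blocks-oe jacobiPow jacobiPow j l
... | odd j | odd l = trans (blocks-oo jacobiPow jacobiPow j l) (jacobiPow-vanish j l (double-cancel-< j l (ℕₚ.≤-pred r<p)))

U-diag : ∀ r → U r r ≡ 1ℙ
U-diag r with halves r
... | even j = trans (blocks-ee jacobiPow jacobiPow j j) (jacobiPow-diag j)
... | odd j = trans (blocks-oo jacobiPow jacobiPow j j) (jacobiPow-diag j)

sumBelow-U : ∀ n r (X : ℕ → Parity) → r < n → sumBelow n (λ p → U r p · X p) ≡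
  sumBelow (suc r) (λ l → U r (double l) · X (double l)) ⊕ sumBelow (suc r) (λ l → U r (suc (double l)) · X (suc (double l)))
sumBelow-U n r X r<n = trans
  (sumBelow-support (suc r) n (double (suc r)) (λ p → U r p · X p) r<n (n≤double (suc r)) λ p r<p → cong (_· X p) (U-vanish r p r<p))
  (sumBelow-double (suc r) (λ p → U r p · X p))

UK-halves : ∀ r s →
  sumBelow (suc r) (λ l → U r (double l) · K (double l) s) ⊕ sumBelow (suc r) (λ l → U r (suc (double l)) · K (suc (double l)) s)
  ≡ coeff₂ (r + s)
UK-halves r s with halves r | halves s
... | even j | even k = begin
  sumBelow (suc (double j)) (λ l → U (double j) (double l) · K (double l) (double k)) ⊕ _
    ≡⟨ cong₂ _⊕_ (sumBelow-cong (suc (double j)) λ l _ → cong₂ _·_ (blocks-ee jacobiPow jacobiPow j l) (blocks-ee Kₑ Kₒ l k))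
                 (sumBelow-zeroˡ (suc (double j)) (λ l → U (double j) (suc (double l))) (λ l → K (suc (double l)) (double k))
                   λ l → blocks-eo jacobiPow jacobiPow j l) ⟩
  sumBelow (suc (double j)) (λ l → jacobiPow j l · jacobiPow k l) ⊕ 0ℙ
    ≡⟨ Parityₚ.+-identityʳ (sumBelow (suc (double j)) (λ l → jacobiPow j l · jacobiPow k l)) ⟩
  sumBelow (suc (double j)) (λ l → jacobiPow j l · jacobiPow k l)
    ≡⟨ dot-jacobiPow-range j (jacobiPow k) (suc (double j)) (suc (j + k)) (s≤s (n≤double j)) (s≤s (m≤m+n j k)) ⟩
  dot (suc (j + k)) (jacobiPow j) (jacobiPow k)
    ≡⟨ dot-jacobiPow j k (suc (j + k)) ≤-refl ⟩
  jacobiPow (j + k) 0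
    ≡⟨ trans (cong coeff₂ (double-+ j k)) (coeff₂-even≡jacobiPow (j + k)) ⟨
  coeff₂ (double j + double k) ∎
  where open ≡-Reasoning
... | even j | odd k = begin
  sumBelow (suc (double j)) (λ l → U (double j) (double l) · K (double l) (suc (double k))) ⊕ _
    ≡⟨ cong₂ _⊕_ (sumBelow-zeroʳ (suc (double j)) (λ l → U (double j) (double l)) (λ l → K (double l) (suc (double k)))
                   λ l → blocks-eo Kₑ Kₒ l k)
                 (sumBelow-zeroˡ (suc (double j)) (λ l → U (double j) (suc (double l))) (λ l → K (suc (double l)) (suc (double k)))
                   λ l → blocks-eo jacobiPow jacobiPow j l) ⟩
  0ℙ
    ≡⟨ coeff₂-odd (j + k) ⟨
  coeff₂ (suc (double (j + k)))
    ≡⟨ cong coeff₂ (trans (+-suc (double j) (double k)) (cong suc (double-+ j k))) ⟨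
  coeff₂ (double j + suc (double k)) ∎
  where open ≡-Reasoning
... | odd j | even k = begin
  sumBelow (suc (suc (double j))) (λ l → U (suc (double j)) (double l) · K (double l) (double k)) ⊕ _
    ≡⟨ cong₂ _⊕_ (sumBelow-zeroˡ (suc (suc (double j))) (λ l → U (suc (double j)) (double l)) (λ l → K (double l) (double k))
                   λ l → blocks-oe jacobiPow jacobiPow j l)
                 (sumBelow-zeroʳ (suc (suc (double j))) (λ l → U (suc (double j)) (suc (double l))) (λ l → K (suc (double l)) (double k))
                   λ l → blocks-oe Kₑ Kₒ l k) ⟩
  0ℙ
    ≡⟨ coeff₂-odd (j + k) ⟨
  coeff₂ (suc (double (j + k)))
    ≡⟨ cong (coeff₂ ∘ suc) (double-+ j k) ⟨
  coeff₂ (suc (double j) + double k) ∎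
  where open ≡-Reasoning
... | odd j | odd k = begin
  sumBelow (suc (suc (double j))) (λ l → U (suc (double j)) (double l) · K (double l) (suc (double k))) ⊕ _
    ≡⟨ cong₂ _⊕_ (sumBelow-zeroˡ (suc (suc (double j))) (λ l → U (suc (double j)) (double l)) (λ l → K (double l) (suc (double k)))
                   λ l → blocks-oe jacobiPow jacobiPow j l)
                 (sumBelow-cong (suc (suc (double j))) λ l _ → cong₂ _·_ (blocks-oo jacobiPow jacobiPow j l) (blocks-oo Kₑ Kₒ l k)) ⟩
  sumBelow (suc (suc (double j))) (λ l → jacobiPow j l · jacobiPow (suc k) l)
    ≡⟨ dot-jacobiPow-range j (jacobiPow (suc k)) (suc (suc (double j))) (suc (j + suc k)) (s≤s (≤-trans (n≤double j) (n≤1+n _))) (s≤s (m≤m+n j (suc k))) ⟩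
  dot (suc (j + suc k)) (jacobiPow j) (jacobiPow (suc k))
    ≡⟨ dot-jacobiPow j (suc k) (suc (j + suc k)) ≤-refl ⟩
  jacobiPow (j + suc k) 0
    ≡⟨ coeff₂-even≡jacobiPow (j + suc k) ⟨
  coeff₂ (double (j + suc k))
    ≡⟨ cong coeff₂ (double-+ j (suc k)) ⟨
  coeff₂ (double j + double (suc k))
    ≡⟨ cong coeff₂ (+-suc (double j) (suc (double k))) ⟩
  coeff₂ (suc (double j) + suc (double k)) ∎
  where open ≡-Reasoning

UK≡coeff₂ : ∀ n r s → r < n → sumBelow n (λ p → U r p · K p s) ≡ coeff₂ (r + s)
UK≡coeff₂ n r s r<n = trans (sumBelow-U n r (λ p → K p s) r<n) (UK-halves r s)

UD-halves : ∀ r s →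
  sumBelow (suc r) (λ l → U r (double l) · D (double l) s) ⊕ sumBelow (suc r) (λ l → U r (suc (double l)) · D (suc (double l)) s)
  ≡ K s r
UD-halves r s with halves r | halves s
... | even j | even k = begin
  sumBelow (suc (double j)) (λ l → U (double j) (double l) · D (double l) (double k)) ⊕ _
    ≡⟨ cong₂ _⊕_ (sumBelow-cong (suc (double j)) λ l _ → cong₂ _·_ (blocks-ee jacobiPow jacobiPow j l) (blocks-ee δ jacobiEntry l k))
                 (sumBelow-zeroˡ (suc (double j)) (λ l → U (double j) (suc (double l))) (λ l → D (suc (double l)) (double k))
                   λ l → blocks-eo jacobiPow jacobiPow j l) ⟩
  sumBelow (suc (double j)) (λ l → jacobiPow j l · δ l k) ⊕ 0ℙ
    ≡⟨ Parityₚ.+-identityʳ (sumBelow (suc (double j)) (λ l → jacobiPow j l · δ l k)) ⟩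
  sumBelow (suc (double j)) (λ l → jacobiPow j l · δ l k)
    ≡⟨ dot-jacobiPow-range j (λ l → δ l k) (suc (double j)) (suc (j + k)) (s≤s (n≤double j)) (s≤s (m≤m+n j k)) ⟩
  sumBelow (suc (j + k)) (λ l → jacobiPow j l · δ l k)
    ≡⟨ sumBelow-δ (suc (j + k)) (jacobiPow j) k (s≤s (m≤n+m k j)) ⟩
  jacobiPow j k
    ≡⟨ blocks-ee Kₑ Kₒ k j ⟨
  K (double k) (double j) ∎
  where open ≡-Reasoning
... | even j | odd k = trans
  (cong₂ _⊕_ (sumBelow-zeroʳ (suc (double j)) (λ l → U (double j) (double l)) (λ l → D (double l) (suc (double k)))
               λ l → blocks-eo δ jacobiEntry l k)
             (sumBelow-zeroˡ (suc (double j)) (λ l → U (double j) (suc (double l))) (λ l → D (suc (double l)) (suc (double k)))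
               λ l → blocks-eo jacobiPow jacobiPow j l))
  (sym (blocks-oe Kₑ Kₒ k j))
... | odd j | even k = trans
  (cong₂ _⊕_ (sumBelow-zeroˡ (suc (suc (double j))) (λ l → U (suc (double j)) (double l)) (λ l → D (double l) (double k))
               λ l → blocks-oe jacobiPow jacobiPow j l)
             (sumBelow-zeroʳ (suc (suc (double j))) (λ l → U (suc (double j)) (suc (double l))) (λ l → D (suc (double l)) (double k))
               λ l → blocks-oe δ jacobiEntry l k))
  (sym (blocks-eo Kₑ Kₒ k j))
... | odd j | odd k = begin
  sumBelow (suc (suc (double j))) (λ l → U (suc (double j)) (double l) · D (double l) (suc (double k))) ⊕ _
    ≡⟨ cong₂ _⊕_ (sumBelow-zeroˡ (suc (suc (double j))) (λ l → U (suc (double j)) (double l)) (λ l → D (double l) (suc (double k)))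
                   λ l → blocks-oe jacobiPow jacobiPow j l)
                 (sumBelow-cong (suc (suc (double j))) λ l _ → cong₂ _·_ (blocks-oo jacobiPow jacobiPow j l) (blocks-oo δ jacobiEntry l k)) ⟩
  sumBelow (suc (suc (double j))) (λ l → jacobiPow j l · jacobi eₖ l)
    ≡⟨ dot-jacobiPow-range j (jacobi eₖ) (suc (suc (double j))) (suc B) (s≤s (≤-trans (n≤double j) (n≤1+n _))) (s≤s (≤-trans (m≤m+n j k) (n≤1+n _))) ⟩
  dot (suc B) (jacobiPow j) (jacobi eₖ)
    ≡⟨ jacobi-selfAdjoint B (jacobiPow j) eₖ (jacobiPow-vanish j (suc B) (s≤s (≤-trans (m≤m+n j k) (n≤1+n _))))
                                            (δ-< (suc B) k (s≤s (≤-trans (m≤n+m k j) (n≤1+n _)))) ⟨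
  dot (suc B) (jacobiPow (suc j)) eₖ
    ≡⟨ sumBelow-δ (suc B) (jacobiPow (suc j)) k (s≤s (≤-trans (m≤n+m k j) (n≤1+n _))) ⟩
  jacobiPow (suc j) k
    ≡⟨ blocks-oo Kₑ Kₒ k j ⟨
  K (suc (double k)) (suc (double j)) ∎
  where
  open ≡-Reasoning
  B = suc (j + k)
  eₖ : ℕ → Parity
  eₖ x = δ x k

UD≡Kᵀ : ∀ n r s → r < n → sumBelow n (λ p → U r p · D p s) ≡ K s r
UD≡Kᵀ n r s r<n = trans (sumBelow-U n r (λ p → D p s) r<n) (UD-halves r s)

-- The matrix D and its band sections

jacobiEntry-δ : ∀ l k → jacobiEntry l k ≡ δ l (suc k) ⊕ evenℙ l · δ l k ⊕ δ (suc l) k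
jacobiEntry-δ zero k = refl
jacobiEntry-δ (suc l) k = refl

jacobiEntry-sym : ∀ l k → jacobiEntry l k ≡ jacobiEntry k l
jacobiEntry-sym l k = begin
  jacobiEntry l k                                     ≡⟨ jacobiEntry-δ l k ⟩
  δ l (suc k) ⊕ evenℙ l · δ l k ⊕ δ (suc l) k         ≡⟨ ⊕-reverse₃ (δ l (suc k)) _ (δ (suc l) k) ⟩
  δ (suc l) k ⊕ evenℙ l · δ l k ⊕ δ l (suc k)         ≡⟨ cong₂ (λ x y → x ⊕ y ⊕ δ l (suc k)) (δ-sym (suc l) k) (·-δ-sym evenℙ l k) ⟩
  δ k (suc l) ⊕ evenℙ k · δ k l ⊕ δ l (suc k)         ≡⟨ cong (δ k (suc l) ⊕ evenℙ k · δ k l ⊕_) (δ-sym l (suc k)) ⟩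
  δ k (suc l) ⊕ evenℙ k · δ k l ⊕ δ (suc k) l         ≡⟨ jacobiEntry-δ k l ⟨
  jacobiEntry k l                                     ∎
  where open ≡-Reasoning

D-sym : ∀ p q → D p q ≡ D q p
D-sym p q with halves p | halves q
... | even l | even k = trans (blocks-ee δ jacobiEntry l k) (trans (δ-sym l k) (sym (blocks-ee δ jacobiEntry k l)))
... | even l | odd k = trans (blocks-eo δ jacobiEntry l k) (sym (blocks-oe δ jacobiEntry k l))
... | odd l | even k = trans (blocks-oe δ jacobiEntry l k) (sym (blocks-eo δ jacobiEntry k l))
... | odd l | odd k = trans (blocks-oo δ jacobiEntry l k)
                        (trans (jacobiEntry-sym l k) (sym (blocks-oo δ jacobiEntry k l)))

-- The section of D starting at index o: b = parity o, and e = evenℙ ⌊ o /2⌋ is the diagonal entry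
-- of the Jacobi block at the first odd index.
bandRowℕ : Parity → Parity → ℕ → Parity
bandRowℕ 0ℙ e k = δ k 0
bandRowℕ 1ℙ e k = e · δ k 0 ⊕ δ k 2

bandRow : Parity → Parity → ∀ {n} → Fin n → Parity
bandRow 0ℙ e zero = 1ℙ
bandRow 0ℙ e (suc c) = 0ℙ
bandRow 1ℙ e zero = e
bandRow 1ℙ e (suc zero) = 0ℙ
bandRow 1ℙ e (suc (suc zero)) = 1ℙ
bandRow 1ℙ e (suc (suc (suc c))) = 0ℙ

band : Parity → Parity → ∀ {n} → Matrix n
band b e zero c = bandRow b e c
band b e (suc r) zero = bandRow b e (suc r)
band b e (suc r) (suc c) = band (b ⁻¹) (b ⊕ e) r c

bandRow≡bandRowℕ : ∀ b e {n} (c : Fin n) → bandRow b e c ≡ bandRowℕ b e (toℕ c)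
bandRow≡bandRowℕ 0ℙ e zero = refl
bandRow≡bandRowℕ 0ℙ e (suc c) = refl
bandRow≡bandRowℕ 1ℙ e zero = sym (trans (Parityₚ.+-identityʳ (e · 1ℙ)) (Parityₚ.*-identityʳ e))
bandRow≡bandRowℕ 1ℙ e (suc zero) = sym (trans (Parityₚ.+-identityʳ (e · 0ℙ)) (Parityₚ.*-zeroʳ e))
bandRow≡bandRowℕ 1ℙ e (suc (suc zero)) = sym (cong (_⊕ 1ℙ) (Parityₚ.*-zeroʳ e))
bandRow≡bandRowℕ 1ℙ e (suc (suc (suc c))) = sym (trans (Parityₚ.+-identityʳ (e · 0ℙ)) (Parityₚ.*-zeroʳ e))

D-row0 : ∀ o k → D o (o + k) ≡ bandRowℕ (parity o) (evenℙ ⌊ o /2⌋) k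
D-row0 o k with halves o | halves k
... | even i | even l = begin
  D (double i) (double i + double l)     ≡⟨ cong (D (double i)) (double-+ i l) ⟩
  D (double i) (double (i + l))          ≡⟨ blocks-ee δ jacobiEntry i (i + l) ⟩
  δ i (i + l)                            ≡⟨ δ-shiftˡ i l ⟩
  δ 0 l                                  ≡⟨ trans (δ-sym 0 l) (sym (δ-double l 0)) ⟩
  δ (double l) 0                         ≡⟨ cong (λ b → bandRowℕ b (evenℙ ⌊ double i /2⌋) (double l)) (parity-double i) ⟨
  bandRowℕ (parity (double i)) (evenℙ ⌊ double i /2⌋) (double l) ∎
  where open ≡-Reasoning
... | even i | odd l = begin
  D (double i) (double i + suc (double l))  ≡⟨ cong (D (double i)) (trans (+-suc (double i) (double l)) (cong suc (double-+ i l))) ⟩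
  D (double i) (suc (double (i + l)))       ≡⟨ blocks-eo δ jacobiEntry i (i + l) ⟩
  0ℙ                                        ≡⟨ cong (λ b → bandRowℕ b (evenℙ ⌊ double i /2⌋) (suc (double l))) (parity-double i) ⟨
  bandRowℕ (parity (double i)) (evenℙ ⌊ double i /2⌋) (suc (double l)) ∎
  where open ≡-Reasoning
... | odd i | even l = begin
  D (suc (double i)) (suc (double i + double l))
    ≡⟨ cong (λ x → D (suc (double i)) (suc x)) (double-+ i l) ⟩
  D (suc (double i)) (suc (double (i + l)))
    ≡⟨ blocks-oo δ jacobiEntry i (i + l) ⟩
  jacobiEntry i (i + l)
    ≡⟨ jacobiEntry-δ i (i + l) ⟩
  δ i (suc (i + l)) ⊕ evenℙ i · δ i (i + l) ⊕ δ (suc i) (i + l)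
    ≡⟨ cong₂ (λ x y → x ⊕ evenℙ i · y ⊕ δ (suc i) (i + l)) (trans (cong (δ i) (sym (+-suc i l))) (δ-shiftˡ i (suc l))) (δ-shiftˡ i l) ⟩
  evenℙ i · δ 0 l ⊕ δ (suc i) (i + l)
    ≡⟨ cong₂ (λ x y → evenℙ i · x ⊕ y) (trans (δ-sym 0 l) (sym (δ-double l 0))) (trans step (sym (δ-double l 1))) ⟩
  evenℙ i · δ (double l) 0 ⊕ δ (double l) 2
    ≡⟨ cong₂ (λ b e → bandRowℕ b e (double l)) (trans (parity-suc (double i)) (cong _⁻¹ (parity-double i))) (cong evenℙ (half-suc-double i)) ⟨
  bandRowℕ (parity (suc (double i))) (evenℙ ⌊ suc (double i) /2⌋) (double l) ∎
  where
  open ≡-Reasoning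
  step : δ (suc i) (i + l) ≡ δ l 1
  step = trans (cong (λ x → δ x (i + l)) (trans (cong suc (sym (ℕₚ.+-identityʳ i))) (sym (+-suc i 0)))) (trans (δ-shift i 1 l) (δ-sym 1 l))
... | odd i | odd l = begin
  D (suc (double i)) (suc (double i + suc (double l)))
    ≡⟨ cong (λ x → D (suc (double i)) (suc x)) (trans (+-suc (double i) (double l)) (cong suc (double-+ i l))) ⟩
  D (suc (double i)) (double (suc (i + l)))
    ≡⟨ blocks-oe δ jacobiEntry i (suc (i + l)) ⟩
  0ℙ
    ≡⟨ cong₂ _⊕_ (Parityₚ.*-zeroʳ (evenℙ i)) (δ-≢ (double l) 1 (double≢suc-double l 0)) ⟨
  evenℙ i · δ (suc (double l)) 0 ⊕ δ (suc (double l)) 2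
    ≡⟨ cong₂ (λ b e → bandRowℕ b e (suc (double l))) (trans (parity-suc (double i)) (cong _⁻¹ (parity-double i))) (cong evenℙ (half-suc-double i)) ⟨
  bandRowℕ (parity (suc (double i))) (evenℙ ⌊ suc (double i) /2⌋) (suc (double l)) ∎
  where open ≡-Reasoning

evenℙ-half-suc : ∀ o → evenℙ ⌊ suc o /2⌋ ≡ parity o ⊕ evenℙ ⌊ o /2⌋
evenℙ-half-suc o with halves o
... | even i = trans (cong evenℙ (half-suc-double i))
                     (sym (cong₂ _⊕_ (parity-double i) (cong evenℙ (half-double i))))
... | odd i = trans (cong (λ x → evenℙ (suc x)) (half-double i))
                    (sym (cong₂ _⊕_ (trans (parity-suc (double i)) (cong _⁻¹ (parity-double i))) (cong evenℙ (half-suc-double i))))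

D-section : ∀ o {n} (r c : Fin n) → D (o + toℕ r) (o + toℕ c) ≡ band (parity o) (evenℙ ⌊ o /2⌋) r c
D-section o zero c = trans (cong (λ x → D x (o + toℕ c)) (ℕₚ.+-identityʳ o))
  (trans (D-row0 o (toℕ c)) (sym (bandRow≡bandRowℕ (parity o) _ c)))
D-section o (suc r) zero = begin
  D (o + suc (toℕ r)) (o + 0)     ≡⟨ D-sym (o + suc (toℕ r)) (o + 0) ⟩
  D (o + 0) (o + suc (toℕ r))     ≡⟨ cong (λ x → D x (o + suc (toℕ r))) (ℕₚ.+-identityʳ o) ⟩
  D o (o + suc (toℕ r))           ≡⟨ D-row0 o (suc (toℕ r)) ⟩
  bandRowℕ (parity o) (evenℙ ⌊ o /2⌋) (suc (toℕ r)) ≡⟨ bandRow≡bandRowℕ (parity o) _ (suc r) ⟨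
  bandRow (parity o) (evenℙ ⌊ o /2⌋) (suc r) ∎
  where open ≡-Reasoning
D-section o (suc r) (suc c) = begin
  D (o + suc (toℕ r)) (o + suc (toℕ c))   ≡⟨ cong₂ D (+-suc o (toℕ r)) (+-suc o (toℕ c)) ⟩
  D (suc o + toℕ r) (suc o + toℕ c)       ≡⟨ D-section (suc o) r c ⟩
  band (parity (suc o)) (evenℙ ⌊ suc o /2⌋) r c
    ≡⟨ cong₂ (λ b e → band b e r c) (parity-suc o) (evenℙ-half-suc o) ⟩
  band (parity o ⁻¹) (parity o ⊕ evenℙ ⌊ o /2⌋) r c ∎
  where open ≡-Reasoning

det₂-band-even : ∀ n e → det₂ (suc n) (band 0ℙ e) ≡ det₂ n (band 1ℙ e)
det₂-band-even n e = trans (cong (det₂ n (band 1ℙ e) ⊕_) (sum-zero {n} _ λ _ → refl)) (Parityₚ.+-identityʳ _)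

-- Row 0 is (e, 0, 1, 0, …); the minor of the entry 1 has a unit row and then a unit column.
det₂-band-odd : ∀ m e → det₂ (3 + m) (band 1ℙ e) ≡ e · det₂ (2 + m) (band 0ℙ (e ⁻¹)) ⊕ det₂ m (band 0ℙ (e ⁻¹ ⁻¹))
det₂-band-odd m e = cong (e · det₂ (2 + m) (band 0ℙ (e ⁻¹)) ⊕_) (begin
  det₂ (2 + m) N ⊕ sum (λ j → 0ℙ · det₂ (2 + m) (minor (suc (suc (suc j))) M))
    ≡⟨ cong (det₂ (2 + m) N ⊕_) (sum-zero {m} _ λ _ → refl) ⟩
  det₂ (2 + m) N ⊕ 0ℙ
    ≡⟨ Parityₚ.+-identityʳ _ ⟩
  det₂ (2 + m) N
    ≡⟨ cong (det₂ (suc m) Y ⊕_) (sum-zero {m} (λ j → N zero (suc (suc j)) · det₂ (suc m) (minor (suc (suc j)) N)) λ _ → refl) ⟩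
  det₂ (suc m) Y ⊕ 0ℙ
    ≡⟨ Parityₚ.+-identityʳ _ ⟩
  det₂ (suc m) Y
    ≡⟨ det₂≡det₂ᶜ (suc m) Y ⟩
  det₂ᶜ (suc m) Y
    ≡⟨ cong (det₂ᶜ m (λ r c → Y (suc r) (suc c)) ⊕_)
         (sum-zero {m} (λ i → Y (suc i) zero · det₂ᶜ m (λ r c → Y (punchIn (suc i) r) (suc c))) λ _ → refl) ⟩
  det₂ᶜ m (λ r c → Y (suc r) (suc c)) ⊕ 0ℙ
    ≡⟨ Parityₚ.+-identityʳ _ ⟩
  det₂ᶜ m (band 0ℙ (e ⁻¹ ⁻¹))
    ≡⟨ det₂≡det₂ᶜ m (band 0ℙ (e ⁻¹ ⁻¹)) ⟨
  det₂ m (band 0ℙ (e ⁻¹ ⁻¹)) ∎)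
  where
  open ≡-Reasoning
  M : Matrix (3 + m)
  M = band 1ℙ e
  N = minor (suc (suc zero)) M
  Y = minor (suc zero) N

bandDet : ℕ → Parity → Parity
bandDet zero e = 1ℙ
bandDet (suc zero) e = e
bandDet (suc (suc zero)) e = e
bandDet (suc (suc (suc zero))) e = e · bandDet 1 (e ⁻¹) ⊕ 1ℙ
bandDet (suc (suc (suc (suc k)))) e = e · bandDet (suc (suc k)) (e ⁻¹) ⊕ bandDet k (e ⁻¹ ⁻¹)

det₂-band : ∀ n e → det₂ n (band 1ℙ e) ≡ bandDet n e
det₂-band zero e = refl
det₂-band (suc zero) 0ℙ = refl
det₂-band (suc zero) 1ℙ = refl
det₂-band (suc (suc zero)) 0ℙ = refl
det₂-band (suc (suc zero)) 1ℙ = refl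
det₂-band (suc (suc (suc zero))) e = trans (det₂-band-odd 0 e)
  (cong (λ d → e · d ⊕ 1ℙ) (trans (det₂-band-even 1 (e ⁻¹)) (det₂-band 1 (e ⁻¹))))
det₂-band (suc (suc (suc (suc k)))) e = trans (det₂-band-odd (suc k) e)
  (cong₂ (λ x y → e · x ⊕ y) (trans (det₂-band-even (suc (suc k)) (e ⁻¹)) (det₂-band (suc (suc k)) (e ⁻¹)))
                              (trans (det₂-band-even k (e ⁻¹ ⁻¹)) (det₂-band k (e ⁻¹ ⁻¹))))

bandDet-periodic : ∀ k e → bandDet (8 + k) e ≡ bandDet k e
bandDet-periodic zero 0ℙ = refl
bandDet-periodic zero 1ℙ = refl
bandDet-periodic (suc zero) 0ℙ = refl
bandDet-periodic (suc zero) 1ℙ = refl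
bandDet-periodic (suc (suc zero)) 0ℙ = refl
bandDet-periodic (suc (suc zero)) 1ℙ = refl
bandDet-periodic (suc (suc (suc zero))) 0ℙ = refl
bandDet-periodic (suc (suc (suc zero))) 1ℙ = refl
bandDet-periodic (suc (suc (suc (suc k)))) e =
  cong₂ (λ x y → e · x ⊕ y) (bandDet-periodic (suc (suc k)) (e ⁻¹)) (bandDet-periodic k (e ⁻¹ ⁻¹))

-- Hankel determinants of f modulo 2

restrict : ∀ {n} → (ℕ → ℕ → Parity) → Matrix n
restrict X i j = X (toℕ i) (toℕ j)

det₂-hankel≡det₂-D : ∀ n → det₂ n (restrict (λ i j → coeff₂ (i + j))) ≡ det₂ n (restrict D)
det₂-hankel≡det₂-D n = begin
  det₂ n (restrict (λ i j → coeff₂ (i + j)))   ≡⟨ det₂-cong n (λ i j → UK≡coeff₂ n (toℕ i) (toℕ j) (toℕ<n i)) ⟨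
  det₂ n (restrict U *ᴹ restrict K)            ≡⟨ det₂-unitLower-* n (restrict U) (restrict K) U-unit ⟩
  det₂ n (restrict K)                          ≡⟨ det₂-ᵀ n (restrict K) ⟨
  det₂ n (restrict K ᵀ)                        ≡⟨ det₂-cong n (λ i j → UD≡Kᵀ n (toℕ i) (toℕ j) (toℕ<n i)) ⟨
  det₂ n (restrict U *ᴹ restrict D)            ≡⟨ det₂-unitLower-* n (restrict U) (restrict D) U-unit ⟩
  det₂ n (restrict D)                          ∎
  where
  open ≡-Reasoning
  U-unit : IsUnitLowerTriangular (restrict {n} U)
  U-unit = (λ i → U-diag (toℕ i)) , (λ i k → U-vanish (toℕ i) (toℕ k))

hankelParity : ℕ → Parity
hankelParity zero    = 1ℙ
hankelParity (suc n) = bandDet n 1ℙ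

parityℤ-H : ∀ n → parityℤ (H n f) ≡ hankelParity n
parityℤ-H zero = refl
parityℤ-H (suc n) = begin
  parityℤ (H (suc n) f)                                ≡⟨ parityℤ-det (suc n) (λ i j → f (toℕ i + toℕ j)) ⟩
  det₂ (suc n) (restrict (λ i j → coeff₂ (i + j)))     ≡⟨ det₂-hankel≡det₂-D (suc n) ⟩
  det₂ (suc n) (restrict D)                            ≡⟨ det₂-cong (suc n) (D-section 0) ⟩
  det₂ (suc n) (band 0ℙ 1ℙ)                            ≡⟨ det₂-band-even n 1ℙ ⟩
  det₂ n (band 1ℙ 1ℙ)                                  ≡⟨ det₂-band n 1ℙ ⟩
  bandDet n 1ℙ                                         ∎
  where open ≡-Reasoning

hankelParity-periodic : ∀ m k → hankelParity (8 * m + k) ≡ hankelParity k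
hankelParity-periodic zero k = refl
hankelParity-periodic (suc m) k =
  trans (cong hankelParity (8*suc m k)) (trans (period (8 * m + k)) (hankelParity-periodic m k))
  where
  8*suc : ∀ m k → 8 * suc m + k ≡ 8 + (8 * m + k)
  8*suc = solve-∀
  period : ∀ n → hankelParity (8 + n) ≡ hankelParity n
  period zero = refl
  period (suc n) = bandDet-periodic n 1ℙ

proposition3p6 : (m : ℕ) →
    ((i : Fin 6) → (+ 2) ∣ (H (8 N.* m N.+ toℕ i) f - + 1))
    × ((+ 2) ∣ H (8 N.* m N.+ 6) f)
    × ((+ 2) ∣ H (8 N.* m N.+ 7) f)
proposition3p6 m = (λ i → 2∣-1-parityℤ (H (8 * m + toℕ i) f) (trans (parityℤ-H+periodic (toℕ i)) (isOne i)))
                 , 2∣-parityℤ (H (8 * m + 6) f) (parityℤ-H+periodic 6)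
                 , 2∣-parityℤ (H (8 * m + 7) f) (parityℤ-H+periodic 7)
  where
  parityℤ-H+periodic : ∀ k → parityℤ (H (8 * m + k) f) ≡ hankelParity k
  parityℤ-H+periodic k = trans (parityℤ-H (8 * m + k)) (hankelParity-periodic m k)
  isOne : (i : Fin 6) → hankelParity (toℕ i) ≡ 1ℙ
  isOne zero = refl
  isOne (suc zero) = refl
  isOne (suc (suc zero)) = refl
  isOne (suc (suc (suc zero))) = refl
  isOne (suc (suc (suc (suc zero)))) = refl
  isOne (suc (suc (suc (suc (suc zero))))) = refl
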